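{- Let $k \ge 2$ be an integer, $p$ a prime, $M \ge 1$ an integer, $r$ a prime with $r > Mk$, $i \ge 1$ an integer, $t = r^i$ and $q = p^t$. Let $\theta$ be a generator of $\mathbb{F}_{q^2}^{*}$ and let $B = \{ b \in \mathbb{Z}_{q^2-1} : \theta^{b} + \theta^{qb} = 1 \}$. Let $\pi : B \to B$ be the permutation $\pi(b) = pb$. Construct $A \subset B$ as follows: for each cycle $\sigma = (b_1, b_2, \dots, b_m)$ of $\pi$ (so $b_{j+1} = p b_j$ and $p b_m = b_1$, with some chosen starting element $b_1$), if $m < k$ remove all elements of $\sigma$ from $B$, and if $m \ge k$ remove those $b_j$ for which $j$ is not divisible by $k$; let $A$ be the set of remaining elements of $B$. Then \[ |A| \geq \frac{q}{k}\left( 1 - \frac{1}{M} \right) - (p^4 - 1)(M - 1). \]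
   Context: $\mathbb{Z}_{q^2-1} = \mathbb{Z}/(q^2-1)\mathbb{Z}$, and $\theta^b$ is well defined for $b \in \mathbb{Z}_{q^2-1}$. The map $b \mapsto pb$ sends $B$ bijectively to itself, so $\pi$ is a permutation of $B$. -}

module Defs where

open import Level using (Level)
open import Data.Nat using (ℕ; zero; suc; _+_; _*_; _∸_; _^_; _≤_; _%_; _≡ᵇ_)
open import Data.Nat.Divisibility using (_∣_; _∣?_)
open import Data.Bool using (Bool; true; false; if_then_else_)
open import Data.List using (List; filter; length; upTo)
open import Data.Product using (Σ; _×_; _,_)
open import Relation.Nullary using (¬_; Dec; _×-dec_)
open import Relation.Nullary.Decidable using (⌊_⌋)
open import Relation.Binary using (Decidable)
open import Relation.Binary.PropositionalEquality using (_≡_)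
open import Algebra.Bundles using (CommutativeRing)
import Data.Nat.Properties as ℕP

iter : {A : Set} → (A → A) → ℕ → A → A
iter f zero    x = x
iter f (suc n) x = f (iter f n x)

-- reduction modulo n (representatives 0..n-1 of ℤ_n); mod 0 is unused
modN : ℕ → ℕ → ℕ
modN zero    b = b
modN (suc n) b = b % suc n

-- least i < n with f i = true, or n if there is none
search : (ℕ → Bool) → ℕ → ℕ
search f zero    = zero
search f (suc n) = if f zero then zero else suc (search (λ i → f (suc i)) n)

module FieldDefs {c ℓ : Level} (F : CommutativeRing c ℓ) where
  open CommutativeRing F renaming (_+_ to _+F_; _*_ to _*F_)

  IsField : Set (c Level.⊔ ℓ)
  IsField = (¬ (1# ≈ 0#)) × (∀ x → ¬ (x ≈ 0#) → Σ Carrier λ y → x *F y ≈ 1#)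

  pow : Carrier → ℕ → Carrier
  pow x zero    = 1#
  pow x (suc n) = x *F pow x n

  IsGenerator : Carrier → ℕ → Set (c Level.⊔ ℓ)
  IsGenerator θ N =
      (pow θ N ≈ 1#)
    × (∀ j → 1 ≤ j → suc j ≤ N → ¬ (pow θ j ≈ 1#))
    × (∀ x → ¬ (x ≈ 0#) → Σ ℕ λ j → (suc j ≤ N) × (x ≈ pow θ j))

  module Construction (_≟_ : Decidable _≈_) (θ : Carrier) (p q k : ℕ) where
    -- ℤ_{q²-1} represented by 0 .. N-1
    N : ℕ
    N = q * q ∸ 1

    InB : ℕ → Set ℓ
    InB b = pow θ b +F pow θ (q * b) ≈ 1#

    inB? : (b : ℕ) → Dec (InB b)
    inB? b = (pow θ b +F pow θ (q * b)) ≟ 1#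

    π : ℕ → ℕ
    π b = modN N (p * b)

    cycleLen : ℕ → ℕ
    cycleLen b = suc (search (λ i → iter π (suc i) b ≡ᵇ b) N)

    -- a choice of starting element b₁ for every cycle of π on B
    StartChoice : (ℕ → ℕ) → Set ℓ
    StartChoice start =
      ∀ b → suc b ≤ N → InB b →
          (suc (start b) ≤ N) × InB (start b)
        × (start (π b) ≡ start b)
        × (Σ ℕ λ s → iter π s (start b) ≡ b)

    -- position j of b in its cycle (b₁, …, b_m) with b_j = π^{j-1} b₁
    position : (ℕ → ℕ) → ℕ → ℕ
    position start b = suc (search (λ s → iter π s (start b) ≡ᵇ b) N)

    InA : (ℕ → ℕ) → ℕ → Set ℓ
    InA start b = InB b × (k ≤ cycleLen b) × (k ∣ position start b)

    inA? : (start : ℕ → ℕ) → (b : ℕ) → Dec (InA start b)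
    inA? start b = inB? b ×-dec ((k ℕP.≤? cycleLen b) ×-dec (k ∣? position start b))

    cardA : (ℕ → ℕ) → ℕ
    cardA start = length (filter (inA? start) (upTo N))

-- Let Φ x = x^q and Tr x = x + Φ x on F = 𝔽_{q²}; then b ∈ B iff Tr θ^b = 1. Since p-th powering is additive,
-- Φ is an additive involution, so Tr takes values among the at most q fixed points of Φ, and every fibre of Tr
-- is a translate of the fibre over 1; hence q² ≤ q |B| and |B| ≥ q. Cycles of π have length dividing 2 rⁱ:
-- those of length at most 2 lie in the solutions of p² b = b, at most p² - 1 ≤ p⁴ - 1 of them, while all others
-- have length at least r > k M. A cycle of length m ≥ k M keeps ⌊m / k⌋ ≥ m (M - 1) / (k M) of its elements,
-- which is shown by sending M - 1 copies of each element of the cycle, in consecutive blocks of k M, to the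
-- kept positions.

module Submission where

open import Defs
open import Level using (Level)
open import Data.Nat using (ℕ; _+_; _*_; _∸_; _^_; _≤_)
open import Data.Nat.Primality using (Prime)
open import Relation.Binary using (Decidable)
open import Algebra.Bundles using (CommutativeRing)
open import Data.Product using (Σ)
open import Relation.Binary.PropositionalEquality using (_≡_)

module Counting where

  open import Data.Nat
  open import Data.Nat.Properties
  open import Data.Bool using (Bool; true; false; T; _∧_; not)
  open import Data.Bool.Properties using (∧-assoc; ∧-zeroʳ)
  open import Data.Empty using (⊥-elim)
  open import Data.Product using (Σ-syntax; _×_; _,_; proj₁; proj₂)
  open import Data.Nat.DivMod using (m<n⇒m%n≡m; [m+n]%n≡m%n)
  open import Data.List using (filter; length; applyUpTo)
  open import Relation.Nullary using (¬_; Dec; yes; no; does)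
  open import Relation.Unary using (Pred) renaming (Decidable to Decidable₁)
  open import Relation.Binary.PropositionalEquality
  open import Algebra.Properties.CommutativeSemigroup +-commutativeSemigroup using (interchange)

  T-ext : ∀ {a b} → (T a → T b) → (T b → T a) → a ≡ b
  T-ext {false} {false} _ _ = refl
  T-ext {false} {true}  _ g = ⊥-elim (g _)
  T-ext {true}  {false} f _ = ⊥-elim (f _)
  T-ext {true}  {true}  _ _ = refl

  T-∧⁻ : ∀ a b → T (a ∧ b) → T a × T b
  T-∧⁻ true true _ = _ , _

  T-∧⁺ : ∀ a b → T a → T b → T (a ∧ b)
  T-∧⁺ true true _ _ = _

  does-sound : ∀ {a} {A : Set a} (A? : Dec A) → T (does A?) → A
  does-sound (yes a) _ = a

  does-complete : ∀ {a} {A : Set a} (A? : Dec A) → A → T (does A?)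
  does-complete (yes _) _ = _
  does-complete (no ¬a) a = ¬a a

  bool→ℕ : Bool → ℕ
  bool→ℕ false = 0
  bool→ℕ true  = 1

  bool→ℕ≤1 : ∀ b → bool→ℕ b ≤ 1
  bool→ℕ≤1 false = z≤n
  bool→ℕ≤1 true  = ≤-refl

  count : (ℕ → Bool) → ℕ → ℕ
  count f zero    = 0
  count f (suc n) = count f n + bool→ℕ (f n)

  count-cong : ∀ f g n → (∀ i → i < n → f i ≡ g i) → count f n ≡ count g n
  count-cong f g zero    _ = refl
  count-cong f g (suc n) e =
    cong₂ _+_ (count-cong f g n (λ i i<n → e i (m<n⇒m<1+n i<n))) (cong bool→ℕ (e n ≤-refl))

  count-mono : ∀ f g n → (∀ i → i < n → T (f i) → T (g i)) → count f n ≤ count g n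
  count-mono f g zero    _ = z≤n
  count-mono f g (suc n) h =
    +-mono-≤ (count-mono f g n (λ i i<n → h i (m<n⇒m<1+n i<n))) (bool→ℕ-mono (f n) (g n) (h n ≤-refl))
    where
    bool→ℕ-mono : ∀ a b → (T a → T b) → bool→ℕ a ≤ bool→ℕ b
    bool→ℕ-mono false _     _ = z≤n
    bool→ℕ-mono true  true  _ = ≤-refl
    bool→ℕ-mono true  false h = ⊥-elim (h _)

  count-true : ∀ f n → (∀ i → i < n → T (f i)) → count f n ≡ n
  count-true f zero    _ = refl
  count-true f (suc n) h with f n | h n ≤-refl
  ... | true | _ = trans (cong (_+ 1) (count-true f n (λ i i<n → h i (m<n⇒m<1+n i<n)))) (+-comm n 1)

  count-false : ∀ f n → (∀ i → i < n → ¬ T (f i)) → count f n ≡ 0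
  count-false f zero    _ = refl
  count-false f (suc n) h with f n | h n ≤-refl
  ... | false | _  = trans (+-identityʳ _) (count-false f n (λ i i<n → h i (m<n⇒m<1+n i<n)))
  ... | true  | ¬t = ⊥-elim (¬t _)

  count-split : (f g : ℕ → Bool) (n : ℕ) → count f n ≡ count (λ i → f i ∧ g i) n + count (λ i → f i ∧ not (g i)) n
  count-split f g zero    = refl
  count-split f g (suc n) = begin
      count f n + bool→ℕ (f n)
    ≡⟨ cong₂ _+_ (count-split f g n) (bool→ℕ-split (f n) (g n)) ⟩
      (a + b) + (c + d)
    ≡⟨ interchange a b c d ⟩
      (a + c) + (b + d) ∎
    where
    open ≡-Reasoning
    a = count (λ i → f i ∧ g i) n
    b = count (λ i → f i ∧ not (g i)) n
    c = bool→ℕ (f n ∧ g n)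
    d = bool→ℕ (f n ∧ not (g n))
    bool→ℕ-split : ∀ x y → bool→ℕ x ≡ bool→ℕ (x ∧ y) + bool→ℕ (x ∧ not y)
    bool→ℕ-split false _     = refl
    bool→ℕ-split true  false = refl
    bool→ℕ-split true  true  = refl

  count-+ : ∀ f m n → count f (m + n) ≡ count f m + count (λ i → f (m + i)) n
  count-+ f m zero    = trans (cong (count f) (+-identityʳ m)) (sym (+-identityʳ _))
  count-+ f m (suc n) = begin
      count f (m + suc n)
    ≡⟨ cong (count f) (+-suc m n) ⟩
      count f (m + n) + bool→ℕ (f (m + n))
    ≡⟨ cong (_+ bool→ℕ (f (m + n))) (count-+ f m n) ⟩
      (count f m + count (λ i → f (m + i)) n) + bool→ℕ (f (m + n))
    ≡⟨ +-assoc (count f m) _ _ ⟩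
      count f m + count (λ i → f (m + i)) (suc n) ∎
    where open ≡-Reasoning

  count-% : ∀ f N .{{_ : NonZero N}} u → count (λ c → f (c % N)) (u * N) ≡ u * count f N
  count-% f N zero    = refl
  count-% f N (suc u) = trans (count-+ _ N (u * N)) (cong₂ _+_
    (count-cong _ f N (λ i i<N → cong f (m<n⇒m%n≡m i<N)))
    (trans (count-cong _ (λ c → f (c % N)) (u * N) (λ i _ → cong f (trans (cong (_% N) (+-comm N i)) ([m+n]%n≡m%n i N))))
           (count-% f N u)))

  count>0⇒∃ : ∀ f n → 0 < count f n → Σ[ i ∈ ℕ ] i < n × T (f i)
  count>0⇒∃ f (suc n) h with f n in eq
  ... | true  = n , ≤-refl , subst T (sym eq) _
  ... | false with count>0⇒∃ f n (subst (0 <_) (+-identityʳ _) h)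
  ...   | i , i<n , fi = i , m<n⇒m<1+n i<n , fi

  count-unique : ∀ f n → (∀ i j → i < n → j < n → T (f i) → T (f j) → i ≡ j) → count f n ≤ 1
  count-unique f zero    _ = z≤n
  count-unique f (suc n) u with f n in eq
  ... | false = subst (_≤ 1) (sym (+-identityʳ _))
                  (count-unique f n (λ i j i<n j<n → u i j (m<n⇒m<1+n i<n) (m<n⇒m<1+n j<n)))
  ... | true  = ≤-reflexive (cong (_+ 1) none-below)
    where
    none-below : count f n ≡ 0
    none-below = count-false f n
      (λ i i<n fi → <-irrefl (u i n (m<n⇒m<1+n i<n) ≤-refl fi (subst T (sym eq) _)) i<n)

  length-filter≡count : ∀ {ℓ} {P : Pred ℕ ℓ} (P? : Decidable₁ P) (f : ℕ → ℕ) n →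
    length (filter P? (applyUpTo f n)) ≡ count (λ i → does (P? (f i))) n
  length-filter≡count P? f zero    = refl
  length-filter≡count P? f (suc n) = trans head+tail (sym (count-+ _ 1 n))
    where
    head+tail : length (filter P? (applyUpTo f (suc n)))
              ≡ bool→ℕ (does (P? (f 0))) + count (λ i → does (P? (f (suc i)))) n
    head+tail with P? (f 0)
    ... | yes _ = cong suc (length-filter≡count P? (λ i → f (suc i)) n)
    ... | no  _ = length-filter≡count P? (λ i → f (suc i)) n

  <ᵇ-suc-∧ : ∀ a k → ((a <ᵇ suc k) ∧ (a <ᵇ k)) ≡ (a <ᵇ k)
  <ᵇ-suc-∧ zero    zero    = refl
  <ᵇ-suc-∧ zero    (suc k) = refl
  <ᵇ-suc-∧ (suc a) zero    = refl
  <ᵇ-suc-∧ (suc a) (suc k) = <ᵇ-suc-∧ a k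

  <ᵇ-suc-∧-not : ∀ a k → ((a <ᵇ suc k) ∧ not (a <ᵇ k)) ≡ (a ≡ᵇ k)
  <ᵇ-suc-∧-not zero    zero    = refl
  <ᵇ-suc-∧-not zero    (suc k) = refl
  <ᵇ-suc-∧-not (suc a) zero    = refl
  <ᵇ-suc-∧-not (suc a) (suc k) = <ᵇ-suc-∧-not a k

  module _ (f g : ℕ → Bool) (h : ℕ → ℕ) (n m c : ℕ)
    (maps-to : ∀ i → i < n → T (f i) → h i < m × T (g (h i)))
    (fibre-≤ : ∀ y → y < m → T (g y) → count (λ i → f i ∧ (h i ≡ᵇ y)) n ≤ c) where

    private
      below : ℕ → ℕ → Bool
      below k i = f i ∧ (h i <ᵇ k)

      count-below : ∀ k → k ≤ m → count (below k) n ≤ c * count g k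
      count-below zero    _   =
        ≤-reflexive (trans (count-false (below 0) n (λ i _ → subst T (∧-zeroʳ (f i)))) (sym (*-zeroʳ c)))
      count-below (suc k) k<m = begin
          count (below (suc k)) n
        ≡⟨ count-split (below (suc k)) (λ i → h i <ᵇ k) n ⟩
          count (λ i → below (suc k) i ∧ (h i <ᵇ k)) n + count (λ i → below (suc k) i ∧ not (h i <ᵇ k)) n
        ≡⟨ cong₂ _+_ (count-cong _ (below k) n λ i _ →
                       trans (∧-assoc (f i) _ _) (cong (f i ∧_) (<ᵇ-suc-∧ (h i) k)))
                     (count-cong _ (λ i → f i ∧ (h i ≡ᵇ k)) n λ i _ →
                       trans (∧-assoc (f i) _ _) (cong (f i ∧_) (<ᵇ-suc-∧-not (h i) k))) ⟩
          count (below k) n + count (λ i → f i ∧ (h i ≡ᵇ k)) n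
        ≤⟨ +-mono-≤ (count-below k (<⇒≤ k<m)) fibre-k ⟩
          c * count g k + c * bool→ℕ (g k)
        ≡⟨ *-distribˡ-+ c (count g k) (bool→ℕ (g k)) ⟨
          c * count g (suc k) ∎
        where
        open ≤-Reasoning
        fibre-k : count (λ i → f i ∧ (h i ≡ᵇ k)) n ≤ c * bool→ℕ (g k)
        fibre-k with g k in eq
        ... | true  = ≤-trans (fibre-≤ k k<m (subst T (sym eq) _)) (≤-reflexive (sym (*-identityʳ c)))
        ... | false = ≤-reflexive (trans (count-false _ n empty) (sym (*-zeroʳ c)))
          where
          empty : ∀ i → i < n → ¬ T (f i ∧ (h i ≡ᵇ k))
          empty i i<n t with T-∧⁻ (f i) _ t
          ... | fi , hi≡k = subst T eq (subst (λ y → T (g y)) (≡ᵇ⇒≡ (h i) k hi≡k) (proj₂ (maps-to i i<n fi)))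

    count-≤-fibres : count f n ≤ c * count g m
    count-≤-fibres = ≤-trans (≤-reflexive (count-cong f (below m) n all-below)) (count-below m ≤-refl)
      where
      all-below : ∀ i → i < n → f i ≡ below m i
      all-below i i<n = T-ext (λ fi → T-∧⁺ (f i) _ fi (<⇒<ᵇ (proj₁ (maps-to i i<n fi)))) (λ t → proj₁ (T-∧⁻ (f i) _ t))

  count-≤-injection : (f g : ℕ → Bool) (h : ℕ → ℕ) (n m : ℕ) →
    (∀ i → i < n → T (f i) → h i < m × T (g (h i))) →
    (∀ i j → i < n → j < n → T (f i) → T (f j) → h i ≡ h j → i ≡ j) →
    count f n ≤ count g m
  count-≤-injection f g h n m maps-to inj =
    ≤-trans (count-≤-fibres f g h n m 1 maps-to fibre-≤-1) (≤-reflexive (*-identityˡ _))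
    where
    fibre-≤-1 : ∀ y → y < m → T (g y) → count (λ i → f i ∧ (h i ≡ᵇ y)) n ≤ 1
    fibre-≤-1 y _ _ = count-unique _ n λ i j i<n j<n ti tj →
      let fi , hi≡y = T-∧⁻ (f i) _ ti
          fj , hj≡y = T-∧⁻ (f j) _ tj
      in inj i j i<n j<n fi fj (trans (≡ᵇ⇒≡ (h i) y hi≡y) (sym (≡ᵇ⇒≡ (h j) y hj≡y)))

module Search where

  open import Data.Nat
  open import Data.Nat.Properties
  open import Data.Bool using (Bool; true; false; T)
  open import Data.Empty using (⊥-elim)
  open import Relation.Nullary using (¬_)
  open import Relation.Binary.PropositionalEquality

  search≤n : ∀ f n → search f n ≤ n
  search≤n f zero    = z≤n
  search≤n f (suc n) with f zero
  ... | true  = z≤n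
  ... | false = s≤s (search≤n (λ i → f (suc i)) n)

  search≤ : ∀ f n i → i < n → T (f i) → search f n ≤ i
  search≤ f (suc n) i i<n fi with f zero in eq
  ... | true = z≤n
  search≤ f (suc n) zero    _         fi | false = ⊥-elim (subst T eq fi)
  search≤ f (suc n) (suc i) (s≤s i<n) fi | false = s≤s (search≤ (λ j → f (suc j)) n i i<n fi)

  search-found : ∀ f n → search f n < n → T (f (search f n))
  search-found f (suc n) lt with f zero in eq
  ... | true  = subst T (sym eq) _
  ... | false = search-found (λ j → f (suc j)) n (≤-pred lt)

  search-least : ∀ f n i → i < search f n → ¬ T (f i)
  search-least f (suc n) i lt with f zero in eq
  search-least f (suc n) i       ()        | true
  search-least f (suc n) zero    _         | false = subst T eq
  search-least f (suc n) (suc i) (s≤s lt)  | false = search-least (λ j → f (suc j)) n i lt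

  search-cong : ∀ f g n → (∀ i → f i ≡ g i) → search f n ≡ search g n
  search-cong f g zero    _ = refl
  search-cong f g (suc n) e rewrite e zero with g zero
  ... | true  = refl
  ... | false = cong suc (search-cong (λ i → f (suc i)) (λ i → g (suc i)) n (λ i → e (suc i)))

  search≡ : ∀ f n i → i < n → T (f i) → (∀ j → j < i → ¬ T (f j)) → search f n ≡ i
  search≡ f n i i<n fi least = ≤-antisym (search≤ f n i i<n fi) (≮⇒≥ λ s<i →
    least (search f n) s<i (search-found f n (<-trans s<i i<n)))

module Iteration {A : Set} where

  open import Data.Nat using (ℕ; zero; suc; _+_)
  open import Relation.Binary.PropositionalEquality

  iter-+ : ∀ (f : A → A) m n x → iter f (m + n) x ≡ iter f m (iter f n x)
  iter-+ f zero    n x = refl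
  iter-+ f (suc m) n x = cong f (iter-+ f m n x)

  iter-commute : ∀ (f : A → A) n x → iter f n (f x) ≡ f (iter f n x)
  iter-commute f zero    x = refl
  iter-commute f (suc n) x = cong f (iter-commute f n x)

module NumberTheory where

  open import Data.Nat
  open import Data.Nat.Properties
  open import Data.Nat.Divisibility
  open import Data.Nat.DivMod using (m≡m%n+[m/n]*n; m%n<n)
  open import Data.Bool using (Bool; T; true)
  open import Data.Nat.Primality using (Prime; prime⇒irreducible; prime⇒nonTrivial; euclidsLemma)
  open import Data.Nat.Coprimality as Coprime using (Coprime; coprime-divisor; prime⇒coprime)
  open import Data.Nat.Combinatorics using (_C_; nCk≡n!/k![n-k]!; k![n∸k]!∣n!)
  open import Data.Nat.DivMod using (m/n*n≡m; m*n/n≡m)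
  open import Data.Product using (Σ-syntax; _,_)
  open import Data.Sum using (inj₁; inj₂)
  open import Data.Empty using (⊥-elim)
  open import Relation.Nullary using (¬_; yes; no)
  open import Relation.Binary.PropositionalEquality
  open import Data.Nat.Tactic.RingSolver using (solve-∀)
  open import Data.Nat.Solver using (module +-*-Solver)
  open +-*-Solver using (solve; _:+_; _:*_; _:=_; con)
  open Counting using (count; count-≤-injection; count-true)

  prime⇒2≤ : ∀ {p} → Prime p → 2 ≤ p
  prime⇒2≤ {p} pp = nonTrivial⇒n>1 p {{prime⇒nonTrivial pp}}

  odd-prime : ∀ {r} → Prime r → 3 ≤ r → Σ[ s ∈ ℕ ] r ≡ suc (2 * s)
  odd-prime {r} rp 3≤r = r / 2 , trans (m≡m%n+[m/n]*n r 2) (cong₂ _+_ r%2≡1 (*-comm (r / 2) 2))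
    where
    r%2≡1 : r % 2 ≡ 1
    r%2≡1 with r % 2 in eq | m%n<n r 2
    ... | 0 | _ with prime⇒irreducible rp (m%n≡0⇒n∣m r 2 eq)
    ...   | inj₁ ()
    ...   | inj₂ 2≡r = ⊥-elim (<-irrefl 2≡r 3≤r)
    r%2≡1 | 1 | _ = refl
    r%2≡1 | suc (suc _) | s≤s (s≤s ())

  odd-^ : ∀ a i → Σ[ s ∈ ℕ ] suc (2 * a) ^ i ≡ suc (2 * s)
  odd-^ a zero    = 0 , refl
  odd-^ a (suc i) with odd-^ a i
  ... | s , e = a + s + 2 * a * s , trans (cong (suc (2 * a) *_) e) (product-of-odds a s)
    where
    product-of-odds : ∀ a s → suc (2 * a) * suc (2 * s) ≡ suc (2 * (a + s + 2 * a * s))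
    product-of-odds = solve-∀

  ^≡1+multiple : ∀ a t → Σ[ g ∈ ℕ ] suc a ^ t ≡ 1 + a * g
  ^≡1+multiple a zero    = 0 , cong suc (sym (*-zeroʳ a))
  ^≡1+multiple a (suc t) with ^≡1+multiple a t
  ... | g , e = suc a * g + 1 , trans (cong (suc a *_) e) (step a g)
    where
    step : ∀ a g → suc a * (1 + a * g) ≡ 1 + a * (suc a * g + 1)
    step = solve-∀

  n<2^n : ∀ n → n < 2 ^ n
  n<2^n zero    = s≤s z≤n
  n<2^n (suc n) = subst₂ _≤_ (+-comm (suc n) 1) (cong (2 ^ n +_) (sym (+-identityʳ (2 ^ n))))
                    (+-mono-≤ (n<2^n n) (m^n>0 2 n))

  coprime-∣-^* : ∀ {m r} → Coprime m r → ∀ i o → m ∣ r ^ i * o → m ∣ o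
  coprime-∣-^* {m}     c zero    o m∣ = subst (m ∣_) (+-identityʳ o) m∣
  coprime-∣-^* {m} {r} c (suc i) o m∣ =
    coprime-∣-^* c i o (coprime-divisor c (subst (m ∣_) (*-assoc r (r ^ i) o) m∣))

  ∣rⁱ*2⇒r≤ : ∀ {m r} i → Prime r → m ∣ r ^ i * 2 → 3 ≤ m → r ≤ m
  ∣rⁱ*2⇒r≤ {m} {r} i rp m∣ 3≤m with m <? r
  ... | no  m≮r = ≮⇒≥ m≮r
  ... | yes m<r = ⊥-elim (<-irrefl refl (≤-trans 3≤m (∣⇒≤ m∣2)))
    where
    instance
      _ : NonZero m
      _ = >-nonZero (≤-trans (s≤s z≤n) 3≤m)
    m∣2 : m ∣ 2
    m∣2 = coprime-∣-^* (Coprime.sym (prime⇒coprime rp m<r)) i 2 m∣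

  -- Ranks d K, …, d K + K - 1 fill the block ending at position (d + 1) k - 1, which exists in a cycle of length m ≥ K.
  block-end< : ∀ k M₁ j u m d → 1 ≤ k → j < m → u < M₁ → d * (k * suc M₁) ≤ j * M₁ + u → k * suc M₁ ≤ m →
               d * k + (k ∸ 1) < m
  block-end< k M₁ j u m d 1≤k j<m u<M₁ dK≤ρ K≤m = begin-strict
      d * k + (k ∸ 1)  <⟨ +-monoʳ-< (d * k) (∸-monoʳ-< {k} {1} {0} (s≤s z≤n) 1≤k) ⟩
      d * k + k        ≡⟨ solve 2 (λ d k → d :* k :+ k := k :* (con 1 :+ d)) refl d k ⟩
      k * suc d        ≤⟨ *-cancelʳ-≤ (k * suc d) m (suc M₁) [d+1]kM≤mM ⟩
      m                ∎
    where
    open ≤-Reasoning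
    ρ<mM₁ : j * M₁ + u < m * M₁
    ρ<mM₁ = begin-strict
      j * M₁ + u   <⟨ +-monoʳ-< (j * M₁) u<M₁ ⟩
      j * M₁ + M₁  ≡⟨ +-comm (j * M₁) M₁ ⟩
      suc j * M₁   ≤⟨ *-monoˡ-≤ M₁ j<m ⟩
      m * M₁       ∎
    [d+1]kM≤mM : k * suc d * suc M₁ ≤ m * suc M₁
    [d+1]kM≤mM = begin
      k * suc d * suc M₁             ≡⟨ solve 3 (λ k d M₁ → k :* (con 1 :+ d) :* (con 1 :+ M₁)
                                                     := d :* (k :* (con 1 :+ M₁)) :+ k :* (con 1 :+ M₁)) refl k d M₁ ⟩
      d * (k * suc M₁) + k * suc M₁  ≤⟨ +-mono-≤ dK≤ρ K≤m ⟩
      j * M₁ + u + m                 ≤⟨ +-monoˡ-≤ m (<⇒≤ ρ<mM₁) ⟩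
      m * M₁ + m                     ≡⟨ solve 2 (λ m M₁ → m :* M₁ :+ m := m :* (con 1 :+ M₁)) refl m M₁ ⟩
      m * suc M₁                     ∎

  private
    p∤m! : ∀ {p} → Prime p → ∀ m → m < p → ¬ (p ∣ m !)
    p∤m! pp zero    m<p p∣ = <-irrefl refl (<-≤-trans (prime⇒2≤ pp) (∣⇒≤ p∣))
    p∤m! pp (suc m) m<p p∣ with euclidsLemma (suc m) (m !) pp p∣
    ... | inj₁ p∣1+m = <-irrefl refl (<-≤-trans m<p (∣⇒≤ p∣1+m))
    ... | inj₂ p∣m!  = p∤m! pp m (<-trans (n<1+n m) m<p) p∣m!

  p∣pCk : ∀ {p} → Prime p → ∀ k → 0 < k → k < p → p ∣ p C k
  p∣pCk {p} pp k 0<k k<p with euclidsLemma (p C k) (k ! * (p ∸ k) !) pp p∣C*k!*[p-k]!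
    where
    instance
      _ : NonZero (k ! * (p ∸ k) !)
      _ = k !* (p ∸ k) !≢0
    p∣C*k!*[p-k]! : p ∣ (p C k) * (k ! * (p ∸ k) !)
    p∣C*k!*[p-k]! = subst (p ∣_)
      (sym (trans (cong (_* (k ! * (p ∸ k) !)) (nCk≡n!/k![n-k]! (<⇒≤ k<p))) (m/n*n≡m (k![n∸k]!∣n! (<⇒≤ k<p)))))
      (p∣p! p (<-≤-trans 0<k (<⇒≤ k<p)))
      where
      p∣p! : ∀ n → 0 < n → n ∣ n !
      p∣p! (suc n) _ = m∣m*n (n !)
  ... | inj₁ p∣C = p∣C
  ... | inj₂ p∣k!*[p-k]! with euclidsLemma (k !) ((p ∸ k) !) pp p∣k!*[p-k]!
  ...   | inj₁ p∣k!     = ⊥-elim (p∤m! pp k k<p p∣k!)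
  ...   | inj₂ p∣[p-k]! = ⊥-elim (p∤m! pp (p ∸ k) (∸-monoʳ-< 0<k (<⇒≤ k<p)) p∣[p-k]!)

  -- Multiplication by 1 + a fixes y modulo a g only if g ∣ y, which leaves a candidates below a g.
  count-fixed-by-*1+ : ∀ {N} a g .{{_ : NonZero N}} → N ≡ a * g → (f : ℕ → Bool) →
    (∀ y → y < N → T (f y) → (suc a * y) % N ≡ y) → count f N ≤ a
  count-fixed-by-*1+ {N} a g refl f fixed =
    ≤-trans (count-≤-injection f (λ _ → true) (_/ g) N a maps-to injective)
            (≤-reflexive (count-true _ a (λ _ _ → _)))
    where
    instance
      a≢0 : NonZero a
      a≢0 = m*n≢0⇒m≢0 a
      g≢0 : NonZero g
      g≢0 = m*n≢0⇒n≢0 a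
    multiple : ∀ y → y < N → T (f y) → y ≡ (y / g) * g
    multiple y y<N fy = trans y≡dg (cong (_* g) (sym (trans (cong (_/ g) y≡dg) (m*n/n≡m d g))))
      where
      d = (suc a * y) / N
      y+ay≡y+dN : y + a * y ≡ y + d * N
      y+ay≡y+dN = trans (m≡m%n+[m/n]*n (suc a * y) N) (cong (_+ d * N) (fixed y y<N fy))
      y≡dg : y ≡ d * g
      y≡dg = *-cancelˡ-≡ y (d * g) a (trans (+-cancelˡ-≡ y _ _ y+ay≡y+dN)
               (solve 3 (λ d a g → d :* (a :* g) := a :* (d :* g)) refl d a g))
    maps-to : ∀ y → y < N → T (f y) → y / g < a Data.Product.× T true
    maps-to y y<N fy = *-cancelʳ-< g (y / g) a (subst (_< N) (multiple y y<N fy) y<N) , _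
    injective : ∀ y z → y < N → z < N → T (f y) → T (f z) → y / g ≡ z / g → y ≡ z
    injective y z y<N z<N fy fz e = trans (multiple y y<N fy) (trans (cong (_* g) e) (sym (multiple z z<N fz)))

module FieldTheory {c ℓ : Level} (F : CommutativeRing c ℓ) (isField : FieldDefs.IsField F)
  (_≟_ : Decidable (CommutativeRing._≈_ F)) where

  open import Data.Nat as ℕ using (ℕ; zero; suc; z≤n; s≤s; _%_; _/_)
  import Data.Nat.Properties as ℕ
  open import Data.Nat.DivMod using (m≡m%n+[m/n]*n; m%n<n)
  open import Data.Nat.Primality using (Prime)
  open import Data.Nat.Divisibility using (_∣_; divides)
  open import Data.Product using (Σ-syntax; _,_; proj₁; proj₂)
  open import Data.Sum using (inj₁; inj₂)
  open import Data.Empty using (⊥-elim)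
  open import Relation.Nullary using (¬_; yes; no; does)
  open import Relation.Binary.Definitions using (tri<; tri≈; tri>)
  import Relation.Binary.PropositionalEquality as ≡
  open ≡ using (_≡_)

  open CommutativeRing F renaming (_+_ to _+F_; _*_ to _*F_)
  open FieldDefs F
  open import Algebra.Properties.Semiring.Mult semiring
    using (_×_; ×-congʳ; ×-homo-0; ×-homo-1; ×1-homo-*; ×-assoc-*; ×-assocˡ)
  open import Relation.Binary.Reasoning.Setoid setoid
  open NumberTheory using (p∣pCk; prime⇒2≤)
  open Search
  open Counting using (does-sound; does-complete)

  1≉0 : ¬ (1# ≈ 0#)
  1≉0 = proj₁ isField

  *-cancelˡ : ∀ x y z → ¬ (x ≈ 0#) → x *F y ≈ x *F z → y ≈ z
  *-cancelˡ x y z x≉0 e with proj₂ isField x x≉0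
  ... | w , xw≈1 = begin
      y               ≈⟨ *-identityˡ y ⟨
      1# *F y         ≈⟨ *-congʳ (trans (sym xw≈1) (*-comm x w)) ⟩
      (w *F x) *F y   ≈⟨ *-assoc w x y ⟩
      w *F (x *F y)   ≈⟨ *-congˡ e ⟩
      w *F (x *F z)   ≈⟨ *-assoc w x z ⟨
      (w *F x) *F z   ≈⟨ *-congʳ (trans (*-comm w x) xw≈1) ⟩
      1# *F z         ≈⟨ *-identityˡ z ⟩
      z               ∎

  *-≉0 : ∀ x y → ¬ (x ≈ 0#) → ¬ (y ≈ 0#) → ¬ (x *F y ≈ 0#)
  *-≉0 x y x≉0 y≉0 xy≈0 = y≉0 (*-cancelˡ x y 0# x≉0 (trans xy≈0 (sym (zeroʳ x))))

  pow-cong : ∀ {x y} n → x ≈ y → pow x n ≈ pow y n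
  pow-cong zero    e = refl
  pow-cong (suc n) e = *-cong e (pow-cong n e)

  pow-+ : ∀ x m n → pow x (m ℕ.+ n) ≈ pow x m *F pow x n
  pow-+ x zero    n = sym (*-identityˡ _)
  pow-+ x (suc m) n = trans (*-congˡ (pow-+ x m n)) (sym (*-assoc _ _ _))

  pow-1# : ∀ n → pow 1# n ≈ 1#
  pow-1# zero    = refl
  pow-1# (suc n) = trans (*-identityˡ _) (pow-1# n)

  pow-distrib-* : ∀ x y n → pow (x *F y) n ≈ pow x n *F pow y n
  pow-distrib-* x y zero    = sym (*-identityˡ _)
  pow-distrib-* x y (suc n) = begin
      (x *F y) *F pow (x *F y) n       ≈⟨ *-congˡ (pow-distrib-* x y n) ⟩
      (x *F y) *F (pow x n *F pow y n) ≈⟨ interchange x y _ _ ⟩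
      (x *F pow x n) *F (y *F pow y n) ∎
    where open import Algebra.Properties.CommutativeSemigroup *-commutativeSemigroup using (interchange)

  pow-* : ∀ x m n → pow x (m ℕ.* n) ≈ pow (pow x m) n
  pow-* x zero    n = sym (pow-1# n)
  pow-* x (suc m) n = begin
      pow x (n ℕ.+ m ℕ.* n)        ≈⟨ pow-+ x n (m ℕ.* n) ⟩
      pow x n *F pow x (m ℕ.* n)   ≈⟨ *-congˡ (pow-* x m n) ⟩
      pow x n *F pow (pow x m) n   ≈⟨ pow-distrib-* x (pow x m) n ⟨
      pow (x *F pow x m) n         ∎

  pow-comm : ∀ x m n → pow (pow x m) n ≈ pow (pow x n) m
  pow-comm x m n = trans (sym (pow-* x m n)) (trans (reflexive (≡.cong (pow x) (ℕ.*-comm m n))) (pow-* x n m))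

  pow-≉0 : ∀ x n → ¬ (x ≈ 0#) → ¬ (pow x n ≈ 0#)
  pow-≉0 x zero    _   = 1≉0
  pow-≉0 x (suc n) x≉0 = *-≉0 x _ x≉0 (pow-≉0 x n x≉0)

  pow≈0⇒≈0 : ∀ x n → pow x n ≈ 0# → x ≈ 0#
  pow≈0⇒≈0 x n xⁿ≈0 with x ≟ 0#
  ... | yes x≈0 = x≈0
  ... | no  x≉0 = ⊥-elim (pow-≉0 x n x≉0 xⁿ≈0)

  ×1-homo-^ : ∀ m n → (m ℕ.^ n) × 1# ≈ pow (m × 1#) n
  ×1-homo-^ m zero    = +-identityʳ 1#
  ×1-homo-^ m (suc n) = trans (×1-homo-* m (m ℕ.^ n)) (*-congˡ (×1-homo-^ m n))

  module Frobenius (p : ℕ) (p-prime : Prime p) (p×1≈0 : p × 1# ≈ 0#) where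
    open import Data.Fin using (Fin; toℕ; fromℕ; inject₁) renaming (zero to fzero; suc to fsuc)
    open import Data.Fin.Properties using (toℕ-fromℕ; toℕ-inject₁; toℕ<n)
    open import Data.Vec.Functional using (init)
    open import Data.Nat.Combinatorics using (_C_; nCn≡1)
    open import Algebra.Properties.CommutativeSemiring.Binomial commutativeSemiring
      using (theorem; binomialExpansion; binomialTerm)
    open import Algebra.Properties.Semiring.Exp semiring using () renaming (_^_ to _^ʳ_)
    open import Algebra.Properties.Monoid.Sum +-monoid using (sum; sum-init-last; sum-cong-≋; sum-replicate-zero)

    pow≈^ : ∀ x n → pow x n ≈ x ^ʳ n
    pow≈^ x zero    = refl
    pow≈^ x (suc n) = *-congˡ (pow≈^ x n)

    multiple-of-p×≈0 : ∀ n z → p ∣ n → n × z ≈ 0#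
    multiple-of-p×≈0 n z (divides d ≡.refl) = begin
      (d ℕ.* p) × z   ≈⟨ ×-assocˡ z d p ⟨
      d × (p × z)     ≈⟨ ×-congʳ d p×z≈0 ⟩
      d × 0#          ≈⟨ ×-congʳ d (×-homo-0 1#) ⟨
      d × (0 × 1#)    ≈⟨ ×-assocˡ 1# d 0 ⟩
      (d ℕ.* 0) × 1#  ≡⟨ ≡.cong (_× 1#) (ℕ.*-zeroʳ d) ⟩
      0#              ∎
      where
      p×z≈0 : p × z ≈ 0#
      p×z≈0 = begin
        p × z            ≈⟨ ×-congʳ p (*-identityˡ z) ⟨
        p × (1# *F z)    ≈⟨ ×-assoc-* p 1# z ⟨
        (p × 1#) *F z    ≈⟨ *-congʳ p×1≈0 ⟩
        0# *F z          ≈⟨ zeroˡ z ⟩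
        0#               ∎

    -- The inner binomial coefficients p C j, 0 < j < p, all vanish in F.
    freshmans-dream : ∀ m → suc m ≡ p → ∀ x y → binomialExpansion x y (suc m) ≈ x ^ʳ suc m +F y ^ʳ suc m
    freshmans-dream m 1+m≡p x y = begin
        term fzero +F sum (λ i → term (fsuc i))
      ≈⟨ +-congˡ (sum-init-last (λ i → term (fsuc i))) ⟩
        term fzero +F (sum (init (λ i → term (fsuc i))) +F term (fsuc (fromℕ m)))
      ≈⟨ +-cong first (+-cong inner last) ⟩
        y ^ʳ suc m +F (0# +F x ^ʳ suc m)
      ≈⟨ trans (+-congˡ (+-identityˡ _)) (+-comm _ _) ⟩
        x ^ʳ suc m +F y ^ʳ suc m ∎
      where
      term = binomialTerm x y (suc m)
      first : term fzero ≈ y ^ʳ suc m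
      first = trans (+-identityʳ _) (*-identityˡ _)
      inner : sum (init (λ i → term (fsuc i))) ≈ 0#
      inner = trans (sum-cong-≋ {m} {init (λ i → term (fsuc i))} {λ _ → 0#} λ j →
                multiple-of-p×≈0 _ _ (≡.subst (λ n → p ∣ (n C toℕ (fsuc (inject₁ j)))) (≡.sym 1+m≡p)
                  (p∣pCk p-prime (toℕ (fsuc (inject₁ j))) (s≤s z≤n)
                    (≡.subst (λ n → suc (toℕ (inject₁ j)) ℕ.< n) 1+m≡p
                      (s≤s (≡.subst (ℕ._< m) (≡.sym (toℕ-inject₁ j)) (toℕ<n j)))))))
                (sum-replicate-zero m)
      last : term (fsuc (fromℕ m)) ≈ x ^ʳ suc m
      last = begin
        (suc m C suc (toℕ (fromℕ m))) × ((x ^ʳ suc (toℕ (fromℕ m))) *F (y ^ʳ (m ℕ.∸ toℕ (fromℕ m))))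
          ≡⟨ ≡.cong (λ w → (suc m C suc w) × ((x ^ʳ suc w) *F (y ^ʳ (m ℕ.∸ w)))) (toℕ-fromℕ m) ⟩
        (suc m C suc m) × ((x ^ʳ suc m) *F (y ^ʳ (m ℕ.∸ m)))
          ≡⟨ ≡.cong₂ (λ a b → a × ((x ^ʳ suc m) *F (y ^ʳ b))) (nCn≡1 (suc m)) (ℕ.n∸n≡0 m) ⟩
        1 × ((x ^ʳ suc m) *F 1#)  ≈⟨ ×-homo-1 _ ⟩
        (x ^ʳ suc m) *F 1#        ≈⟨ *-identityʳ _ ⟩
        x ^ʳ suc m                ∎

    frobenius-+ : ∀ x y → pow (x +F y) p ≈ pow x p +F pow y p
    frobenius-+ x y = ≡.subst (λ n → pow (x +F y) n ≈ pow x n +F pow y n) 1+[p-1]≡p (begin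
      pow (x +F y) (suc m)            ≈⟨ pow≈^ _ (suc m) ⟩
      (x +F y) ^ʳ suc m                ≈⟨ theorem (suc m) x y ⟩
      binomialExpansion x y (suc m)   ≈⟨ freshmans-dream m 1+[p-1]≡p x y ⟩
      x ^ʳ suc m +F y ^ʳ suc m          ≈⟨ +-cong (pow≈^ x (suc m)) (pow≈^ y (suc m)) ⟨
      pow x (suc m) +F pow y (suc m)  ∎)
      where
      m = p ℕ.∸ 1
      1+[p-1]≡p : suc m ≡ p
      1+[p-1]≡p = ℕ.m+[n∸m]≡n (ℕ.≤-trans (s≤s z≤n) (prime⇒2≤ p-prime))

  module Cyclic (θ : Carrier) (N : ℕ) (gen : IsGenerator θ N) where

    θ^N≈1 : pow θ N ≈ 1#
    θ^N≈1 = proj₁ gen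

    θ-order : ∀ j → 1 ℕ.≤ j → j ℕ.< N → ¬ (pow θ j ≈ 1#)
    θ-order = proj₁ (proj₂ gen)

    θ-generates : ∀ x → ¬ (x ≈ 0#) → Σ[ j ∈ ℕ ] j ℕ.< N Data.Product.× x ≈ pow θ j
    θ-generates = proj₂ (proj₂ gen)

    1≤N : 1 ℕ.≤ N
    1≤N = ℕ.≤-trans (s≤s z≤n) (proj₁ (proj₂ (θ-generates 1# 1≉0)))

    instance
      N≢0 : ℕ.NonZero N
      N≢0 = ℕ.>-nonZero 1≤N

    θ≉0 : ¬ (θ ≈ 0#)
    θ≉0 θ≈0 = 1≉0 (trans (sym θ^N≈1)
      (≡.subst (λ n → pow θ n ≈ 0#) (ℕ.suc-pred N) (trans (*-congʳ θ≈0) (zeroˡ _))))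

    θ^≉0 : ∀ a → ¬ (pow θ a ≈ 0#)
    θ^≉0 a = pow-≉0 θ a θ≉0

    θ^[k*N]≈1 : ∀ k → pow θ (k ℕ.* N) ≈ 1#
    θ^[k*N]≈1 k = begin
      pow θ (k ℕ.* N) ≡⟨ ≡.cong (pow θ) (ℕ.*-comm k N) ⟩
      pow θ (N ℕ.* k) ≈⟨ pow-* θ N k ⟩
      pow (pow θ N) k ≈⟨ pow-cong k θ^N≈1 ⟩
      pow 1# k        ≈⟨ pow-1# k ⟩
      1#              ∎

    θ^-mod : ∀ a → pow θ a ≈ pow θ (a % N)
    θ^-mod a = begin
      pow θ a                                 ≡⟨ ≡.cong (pow θ) (m≡m%n+[m/n]*n a N) ⟩
      pow θ (a % N ℕ.+ (a / N) ℕ.* N)         ≈⟨ pow-+ θ (a % N) _ ⟩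
      pow θ (a % N) *F pow θ ((a / N) ℕ.* N)  ≈⟨ *-congˡ (θ^[k*N]≈1 (a / N)) ⟩
      pow θ (a % N) *F 1#                     ≈⟨ *-identityʳ _ ⟩
      pow θ (a % N)                           ∎

    θ^-distinct : ∀ a b → a ℕ.< b → b ℕ.< N → ¬ (pow θ a ≈ pow θ b)
    θ^-distinct a b a<b b<N e = θ-order (b ℕ.∸ a) (ℕ.m<n⇒0<n∸m a<b) (ℕ.≤-<-trans (ℕ.m∸n≤m b a) b<N)
      (*-cancelˡ (pow θ a) _ _ (θ^≉0 a) (begin
        pow θ a *F pow θ (b ℕ.∸ a)  ≈⟨ pow-+ θ a (b ℕ.∸ a) ⟨
        pow θ (a ℕ.+ (b ℕ.∸ a))     ≡⟨ ≡.cong (pow θ) (ℕ.m+[n∸m]≡n (ℕ.<⇒≤ a<b)) ⟩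
        pow θ b                     ≈⟨ e ⟨
        pow θ a                     ≈⟨ *-identityʳ _ ⟨
        pow θ a *F 1#               ∎))

    θ^-injective : ∀ a b → a ℕ.< N → b ℕ.< N → pow θ a ≈ pow θ b → a ≡ b
    θ^-injective a b a<N b<N e with ℕ.<-cmp a b
    ... | tri< a<b _ _ = ⊥-elim (θ^-distinct a b a<b b<N e)
    ... | tri≈ _ a≡b _ = a≡b
    ... | tri> _ _ b<a = ⊥-elim (θ^-distinct b a b<a a<N (sym e))

    θ^≈θ^⇒%≡% : ∀ a b → pow θ a ≈ pow θ b → a % N ≡ b % N
    θ^≈θ^⇒%≡% a b e = θ^-injective _ _ (m%n<n a N) (m%n<n b N) (trans (sym (θ^-mod a)) (trans e (θ^-mod b)))

    pow-1+N : ∀ x → pow x (suc N) ≈ x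
    pow-1+N x with x ≟ 0#
    ... | yes x≈0 = trans (*-congʳ x≈0) (trans (zeroˡ _) (sym x≈0))
    ... | no  x≉0 with θ-generates x x≉0
    ...   | j , _ , x≈θ^j = begin
      x *F pow x N          ≈⟨ *-congˡ (pow-cong N x≈θ^j) ⟩
      x *F pow (pow θ j) N  ≈⟨ *-congˡ (pow-* θ j N) ⟨
      x *F pow θ (j ℕ.* N)  ≈⟨ *-congˡ (θ^[k*N]≈1 j) ⟩
      x *F 1#               ≈⟨ *-identityʳ x ⟩
      x                     ∎

    -- F is enumerated by the indices 0, …, N as θ⁰, …, θ^(N-1), 0.
    enum : ℕ → Carrier
    enum j with j ℕ.<? N
    ... | yes _ = pow θ j
    ... | no  _ = 0#

    enum-< : ∀ j → j ℕ.< N → enum j ≡ pow θ j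
    enum-< j j<N with j ℕ.<? N
    ... | yes _   = ≡.refl
    ... | no  j≮N = ⊥-elim (j≮N j<N)

    enum-N : enum N ≡ 0#
    enum-N with N ℕ.<? N
    ... | yes N<N = ⊥-elim (ℕ.<-irrefl ≡.refl N<N)
    ... | no  _   = ≡.refl

    enum-injective : ∀ i j → i ℕ.≤ N → j ℕ.≤ N → enum i ≈ enum j → i ≡ j
    enum-injective i j i≤N j≤N e with ℕ.m≤n⇒m<n∨m≡n i≤N | ℕ.m≤n⇒m<n∨m≡n j≤N
    ... | inj₁ i<N | inj₁ j<N = θ^-injective i j i<N j<N
      (trans (reflexive (≡.sym (enum-< i i<N))) (trans e (reflexive (enum-< j j<N))))
    ... | inj₁ i<N | inj₂ ≡.refl =
      ⊥-elim (θ^≉0 i (trans (reflexive (≡.sym (enum-< i i<N))) (trans e (reflexive enum-N))))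
    ... | inj₂ ≡.refl | inj₁ j<N =
      ⊥-elim (θ^≉0 j (trans (reflexive (≡.sym (enum-< j j<N))) (trans (sym e) (reflexive enum-N))))
    ... | inj₂ ≡.refl | inj₂ ≡.refl = ≡.refl

    index : Carrier → ℕ
    index x = search (λ j → does (pow θ j ≟ x)) N

    index≤N : ∀ x → index x ℕ.≤ N
    index≤N x = search≤n _ N

    index≡N⇒≈0 : ∀ x → index x ≡ N → x ≈ 0#
    index≡N⇒≈0 x index≡N with x ≟ 0#
    ... | yes x≈0 = x≈0
    ... | no  x≉0 with θ-generates x x≉0
    ...   | j , j<N , x≈θ^j = ⊥-elim (ℕ.<-irrefl ≡.refl (ℕ.≤-<-trans
            (≡.subst (ℕ._≤ j) index≡N (search≤ _ N j j<N (does-complete (pow θ j ≟ x) (sym x≈θ^j)))) j<N))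

    enum-index : ∀ x → enum (index x) ≈ x
    enum-index x with ℕ.m≤n⇒m<n∨m≡n (index≤N x)
    ... | inj₁ index<N = trans (reflexive (enum-< (index x) index<N)) (does-sound (_ ≟ x) (search-found _ N index<N))
    ... | inj₂ index≡N = trans (reflexive (≡.trans (≡.cong enum index≡N) enum-N)) (sym (index≡N⇒≈0 x index≡N))

    index<N : ∀ x → ¬ (x ≈ 0#) → index x ℕ.< N
    index<N x x≉0 with ℕ.m≤n⇒m<n∨m≡n (index≤N x)
    ... | inj₁ index<N = index<N
    ... | inj₂ index≡N = ⊥-elim (x≉0 (index≡N⇒≈0 x index≡N))

    index-injective : ∀ {x y} → index x ≡ index y → x ≈ y
    index-injective {x} {y} e = trans (sym (enum-index x)) (trans (reflexive (≡.cong enum e)) (enum-index y))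

    -- Summing the enumeration of F, shifted by the permutation x ↦ x + 1, adds (N + 1) × 1#.
    characteristic : suc N × 1# ≈ 0#
    characteristic = begin
      suc N × 1#                ≈⟨ +-identityˡ _ ⟨
      0# +F suc N × 1#          ≈⟨ +-congʳ (-‿inverseˡ S) ⟨
      (- S +F S) +F suc N × 1#  ≈⟨ +-assoc _ _ _ ⟩
      - S +F (S +F suc N × 1#)  ≈⟨ +-congˡ S≈S+[1+N]×1 ⟨
      - S +F S                  ≈⟨ -‿inverseˡ S ⟩
      0#                        ∎
      where
      open import Data.Fin using (Fin; toℕ; fromℕ<)
      open import Data.Fin.Properties using (toℕ-fromℕ<; toℕ-injective; toℕ<n)
      open import Data.Fin.Permutation using (Permutation; permutation)
      open import Algebra.Properties.CommutativeMonoid.Sum +-commutativeMonoid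
        using (sum; ∑-permute; ∑-distrib-+; sum-cong-≋; sum-replicate)

      e : Fin (suc N) → Carrier
      e i = enum (toℕ i)

      shift : Carrier → Fin (suc N) → Fin (suc N)
      shift a i = fromℕ< (s≤s (index≤N (e i +F a)))

      e-shift : ∀ a i → e (shift a i) ≈ e i +F a
      e-shift a i = trans (reflexive (≡.cong enum (toℕ-fromℕ< _))) (enum-index _)

      e-injective : ∀ i j → e i ≈ e j → i ≡ j
      e-injective i j eq = toℕ-injective (enum-injective _ _ (ℕ.≤-pred (toℕ<n i)) (ℕ.≤-pred (toℕ<n j)) eq)

      shift-inverse : ∀ a b → b +F a ≈ 0# → ∀ i → shift a (shift b i) ≡ i
      shift-inverse a b b+a≈0 i = e-injective _ _ (begin
        e (shift a (shift b i))  ≈⟨ e-shift a _ ⟩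
        e (shift b i) +F a       ≈⟨ +-congʳ (e-shift b i) ⟩
        (e i +F b) +F a          ≈⟨ +-assoc _ _ _ ⟩
        e i +F (b +F a)          ≈⟨ +-congˡ b+a≈0 ⟩
        e i +F 0#                ≈⟨ +-identityʳ _ ⟩
        e i                      ∎)

      S : Carrier
      S = sum e

      S≈S+[1+N]×1 : S ≈ S +F suc N × 1#
      S≈S+[1+N]×1 = begin
        S                                ≈⟨ ∑-permute e (permutation (shift 1#) (shift (- 1#))
                                              (shift-inverse 1# (- 1#) (-‿inverseˡ 1#)) (shift-inverse (- 1#) 1# (-‿inverseʳ 1#))) ⟩
        sum (λ i → e (shift 1# i))       ≈⟨ sum-cong-≋ (e-shift 1#) ⟩
        sum (λ i → e i +F 1#)            ≈⟨ ∑-distrib-+ e (λ _ → 1#) ⟩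
        S +F sum {suc N} (λ _ → 1#)      ≈⟨ +-congˡ (sum-replicate (suc N)) ⟩
        S +F suc N × 1#                  ∎

module Trace {c ℓ : Level} (F : CommutativeRing c ℓ) (isField : FieldDefs.IsField F)
  (_≟_ : Decidable (CommutativeRing._≈_ F)) (θ : CommutativeRing.Carrier F)
  (p t : ℕ) (p-prime : Prime p) (t-odd : Σ ℕ λ s → t ≡ Data.Nat.suc (2 * s))
  (gen : FieldDefs.IsGenerator F θ (p ^ t * p ^ t ∸ 1)) where

  open import Data.Nat as ℕ using (zero; suc; _<_; z≤n; s≤s; _%_; _/_; _≡ᵇ_)
  import Data.Nat.Properties as ℕ
  open import Data.Nat.DivMod using (m<n⇒m%n≡m)
  open import Data.Product using (Σ-syntax; _,_; proj₁; proj₂)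
  open import Data.Empty using (⊥-elim)
  open import Data.Bool using (Bool; T; true)
  open import Relation.Nullary using (¬_; yes; no; does)
  open import Data.Nat.Tactic.RingSolver using (solve-∀)
  import Relation.Binary.PropositionalEquality as ≡
  open ≡ using (_≡_)

  open CommutativeRing F renaming (_+_ to _+F_; _*_ to _*F_)
  open FieldDefs F
  open import Algebra.Properties.AbelianGroup +-abelianGroup using (inverseʳ-unique; ∙-cancelʳ)
  open import Algebra.Properties.Semiring.Mult semiring using (_×_; ×1-homo-*)
  open import Relation.Binary.Reasoning.Setoid setoid
  open NumberTheory using (prime⇒2≤; ^≡1+multiple; odd-prime; count-fixed-by-*1+)
  open import Function using (_∘_)
  open Counting
  open FieldTheory F isField _≟_
  open Cyclic θ (p ^ t * p ^ t ∸ 1) gen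

  q : ℕ
  q = p ^ t

  N : ℕ
  N = q * q ∸ 1

  2≤p : 2 ≤ p
  2≤p = prime⇒2≤ p-prime

  instance
    p≢0 : ℕ.NonZero p
    p≢0 = ℕ.>-nonZero (ℕ.≤-trans (s≤s z≤n) 2≤p)
    q≢0 : ℕ.NonZero q
    q≢0 = ℕ.m^n≢0 p t

  p≤q : p ≤ q
  p≤q = ℕ.≤-trans (ℕ.≤-reflexive (≡.sym (ℕ.*-identityʳ p))) (ℕ.^-monoʳ-≤ p 1≤t)
    where
    1≤t : 1 ≤ t
    1≤t = ≡.subst (1 ≤_) (≡.sym (proj₂ t-odd)) (s≤s z≤n)

  2≤q : 2 ≤ q
  2≤q = ℕ.≤-trans 2≤p p≤q

  1+N≡q*q : suc N ≡ q * q
  1+N≡q*q = ℕ.m+[n∸m]≡n (ℕ.*-mono-≤ (ℕ.≤-trans (s≤s z≤n) 2≤q) (ℕ.≤-trans (s≤s z≤n) 2≤q))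

  -- (p × 1#)^(2t) = (q²) × 1# = 0#, and F has no nilpotents.
  p×1≈0 : p × 1# ≈ 0#
  p×1≈0 = pow≈0⇒≈0 (p × 1#) (t ℕ.+ t) (begin
    pow (p × 1#) (t ℕ.+ t)   ≈⟨ ×1-homo-^ p (t ℕ.+ t) ⟨
    (p ^ (t ℕ.+ t)) × 1#     ≡⟨ ≡.cong (_× 1#) (≡.trans (ℕ.^-distribˡ-+-* p t t) (≡.sym 1+N≡q*q)) ⟩
    suc N × 1#               ≈⟨ characteristic ⟩
    0#                       ∎)

  open Frobenius p p-prime p×1≈0 using (frobenius-+)

  frobenius-+-^ : ∀ s x y → pow (x +F y) (p ^ s) ≈ pow x (p ^ s) +F pow y (p ^ s)
  frobenius-+-^ zero    x y = trans (*-identityʳ _) (sym (+-cong (*-identityʳ _) (*-identityʳ _)))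
  frobenius-+-^ (suc s) x y = begin
    pow (x +F y) (p * p ^ s)                         ≈⟨ pow-* _ p (p ^ s) ⟩
    pow (pow (x +F y) p) (p ^ s)                     ≈⟨ pow-cong (p ^ s) (frobenius-+ x y) ⟩
    pow (pow x p +F pow y p) (p ^ s)                 ≈⟨ frobenius-+-^ s _ _ ⟩
    pow (pow x p) (p ^ s) +F pow (pow y p) (p ^ s)   ≈⟨ +-cong (pow-* x p (p ^ s)) (pow-* y p (p ^ s)) ⟨
    pow x (p * p ^ s) +F pow y (p * p ^ s)           ∎

  Φ : Carrier → Carrier
  Φ x = pow x q

  Φ-cong : ∀ {x y} → x ≈ y → Φ x ≈ Φ y
  Φ-cong = pow-cong q

  Φ-+ : ∀ x y → Φ (x +F y) ≈ Φ x +F Φ y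
  Φ-+ = frobenius-+-^ t

  Φ-0 : Φ 0# ≈ 0#
  Φ-0 = ≡.subst (λ n → pow 0# n ≈ 0#) (ℕ.m+[n∸m]≡n (ℕ.≤-trans (s≤s z≤n) 2≤q)) (zeroˡ _)

  Φ-involutive : ∀ x → Φ (Φ x) ≈ x
  Φ-involutive x = begin
    pow (pow x q) q   ≈⟨ pow-* x q q ⟨
    pow x (q * q)     ≡⟨ ≡.cong (pow x) (≡.sym 1+N≡q*q) ⟩
    pow x (suc N)     ≈⟨ pow-1+N x ⟩
    x                 ∎

  Tr : Carrier → Carrier
  Tr x = x +F Φ x

  Tr-cong : ∀ {x y} → x ≈ y → Tr x ≈ Tr y
  Tr-cong e = +-cong e (Φ-cong e)

  Tr-+ : ∀ x y → Tr (x +F y) ≈ Tr x +F Tr y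
  Tr-+ x y = trans (+-congˡ (Φ-+ x y)) (interchange x y (Φ x) (Φ y))
    where open import Algebra.Properties.CommutativeSemigroup +-commutativeSemigroup using (interchange)

  Tr-0 : Tr 0# ≈ 0#
  Tr-0 = trans (+-congˡ Φ-0) (+-identityʳ _)

  Tr-neg : ∀ x → Tr (- x) ≈ - Tr x
  Tr-neg x = inverseʳ-unique (Tr x) (Tr (- x)) (trans (sym (Tr-+ x (- x))) (trans (Tr-cong (-‿inverseʳ x)) Tr-0))

  Φ-Tr : ∀ x → Φ (Tr x) ≈ Tr x
  Φ-Tr x = trans (Φ-+ x (Φ x)) (trans (+-congˡ (Φ-involutive x)) (+-comm _ _))

  trace-one-odd : ∀ u → p ≡ suc (2 * u) → Σ[ x ∈ Carrier ] Tr x ≈ 1#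
  trace-one-odd u p≡1+2u = h , Tr-h
    where
    2# : Carrier
    2# = 1# +F 1#

    2#≉0 : ¬ (2# ≈ 0#)
    2#≉0 2#≈0 = 1≉0 (begin
      1#                          ≈⟨ +-identityʳ _ ⟨
      1# +F 0#                    ≈⟨ +-congˡ (zeroˡ (u × 1#)) ⟨
      1# +F 0# *F (u × 1#)        ≈⟨ +-congˡ (*-congʳ (trans (+-congˡ (+-identityʳ 1#)) 2#≈0)) ⟨
      1# +F (2 × 1#) *F (u × 1#)  ≈⟨ +-congˡ (×1-homo-* 2 u) ⟨
      suc (2 * u) × 1#            ≡⟨ ≡.cong (_× 1#) (≡.sym p≡1+2u) ⟩
      p × 1#                      ≈⟨ p×1≈0 ⟩
      0#                          ∎)

    h : Carrier
    h = proj₁ (proj₂ isField 2# 2#≉0)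

    2h≈1 : 2# *F h ≈ 1#
    2h≈1 = proj₂ (proj₂ isField 2# 2#≉0)

    Φ-h : Φ h ≈ h
    Φ-h = *-cancelˡ 2# (Φ h) h 2#≉0 (begin
      2# *F Φ h      ≈⟨ *-congʳ (trans (Φ-+ 1# 1#) (+-cong (pow-1# q) (pow-1# q))) ⟨
      Φ 2# *F Φ h    ≈⟨ pow-distrib-* 2# h q ⟨
      Φ (2# *F h)    ≈⟨ Φ-cong 2h≈1 ⟩
      Φ 1#           ≈⟨ pow-1# q ⟩
      1#             ≈⟨ 2h≈1 ⟨
      2# *F h        ∎)

    Tr-h : Tr h ≈ 1#
    Tr-h = begin
      h +F Φ h              ≈⟨ +-congˡ Φ-h ⟩
      h +F h                ≈⟨ +-cong (*-identityˡ h) (*-identityˡ h) ⟨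
      1# *F h +F 1# *F h    ≈⟨ distribʳ h 1# 1# ⟨
      2# *F h               ≈⟨ 2h≈1 ⟩
      1#                    ∎

  -- For p = 2, t odd gives q ≡ 2 (mod 3), so a primitive cube root of unity ω has Φ ω = ω² and Tr ω = ω + ω² = -1 = 1.
  trace-one-even : p ≡ 2 → Σ[ x ∈ Carrier ] Tr x ≈ 1#
  trace-one-even p≡2 = ω , Tr-ω
    where
    s = proj₁ t-odd
    u = 2 * proj₁ (^≡1+multiple 3 s)

    q≡2+3u : q ≡ 2 + 3 * u
    q≡2+3u = ≡.trans (≡.cong₂ _^_ p≡2 (proj₂ t-odd))
               (≡.trans (≡.cong (2 *_) (≡.sym (ℕ.^-*-assoc 2 2 s)))
               (≡.trans (≡.cong (2 *_) (proj₂ (^≡1+multiple 3 s))) (double (proj₁ (^≡1+multiple 3 s)))))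
      where
      double : ∀ g → 2 * (1 + 3 * g) ≡ 2 + 3 * (2 * g)
      double = solve-∀

    w : ℕ
    w = 1 + 4 * u + 3 * u * u

    N≡3w : N ≡ 3 * w
    N≡3w = ≡.cong (_∸ 1) (≡.trans (≡.cong₂ _*_ q≡2+3u q≡2+3u) (square u))
      where
      square : ∀ u → (2 + 3 * u) * (2 + 3 * u) ≡ 1 + 3 * (1 + 4 * u + 3 * u * u)
      square = solve-∀

    ω : Carrier
    ω = pow θ w

    ω³≈1 : pow ω 3 ≈ 1#
    ω³≈1 = begin
      pow (pow θ w) 3   ≈⟨ pow-* θ w 3 ⟨
      pow θ (w * 3)     ≡⟨ ≡.cong (pow θ) (≡.trans (ℕ.*-comm w 3) (≡.sym N≡3w)) ⟩
      pow θ N           ≈⟨ θ^N≈1 ⟩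
      1#                ∎

    ω≉1 : ¬ (ω ≈ 1#)
    ω≉1 = θ-order w (s≤s z≤n) (≡.subst (w <_) (≡.trans (ℕ.*-comm w 3) (≡.sym N≡3w)) (ℕ.m<m*n w 3 (s≤s (s≤s z≤n))))

    σ : Carrier
    σ = (pow ω 2 +F ω) +F 1#

    ωσ≈σ : ω *F σ ≈ σ
    ωσ≈σ = begin
      ω *F ((pow ω 2 +F ω) +F 1#)         ≈⟨ distribˡ ω _ _ ⟩
      ω *F (pow ω 2 +F ω) +F ω *F 1#      ≈⟨ +-cong (distribˡ ω _ _) (*-identityʳ ω) ⟩
      (pow ω 3 +F ω *F ω) +F ω            ≈⟨ +-congʳ (+-cong ω³≈1 (*-congˡ (sym (*-identityʳ ω)))) ⟩
      (1# +F pow ω 2) +F ω                ≈⟨ +-assoc _ _ _ ⟩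
      1# +F (pow ω 2 +F ω)                ≈⟨ +-comm _ _ ⟩
      σ                                   ∎

    σ≈0 : σ ≈ 0#
    σ≈0 with σ ≟ 0#
    ... | yes σ≈0 = σ≈0
    ... | no  σ≉0 = ⊥-elim (ω≉1 (*-cancelˡ σ ω 1# σ≉0 (trans (*-comm σ ω) (trans ωσ≈σ (sym (*-identityʳ σ))))))

    1+1≈0 : 1# +F 1# ≈ 0#
    1+1≈0 = trans (+-congˡ (sym (+-identityʳ 1#))) (≡.subst (λ n → n × 1# ≈ 0#) p≡2 p×1≈0)

    Φ-ω : Φ ω ≈ pow ω 2
    Φ-ω = begin
      pow ω q                      ≡⟨ ≡.cong (pow ω) q≡2+3u ⟩
      pow ω (2 + 3 * u)            ≈⟨ pow-+ ω 2 (3 * u) ⟩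
      pow ω 2 *F pow ω (3 * u)     ≈⟨ *-congˡ (trans (pow-* ω 3 u) (trans (pow-cong u ω³≈1) (pow-1# u))) ⟩
      pow ω 2 *F 1#                ≈⟨ *-identityʳ _ ⟩
      pow ω 2                      ∎

    Tr-ω : Tr ω ≈ 1#
    Tr-ω = trans (+-congˡ Φ-ω) (trans (+-comm _ _) (∙-cancelʳ 1# _ _ (trans σ≈0 (sym 1+1≈0))))

  trace-one : Σ[ x ∈ Carrier ] Tr x ≈ 1#
  trace-one with p ℕ.≟ 2
  ... | yes p≡2 = trace-one-even p≡2
  ... | no  p≢2 = let (u , p≡1+2u) = odd-prime p-prime (ℕ.≤∧≢⇒< 2≤p (p≢2 ∘ ≡.sym)) in trace-one-odd u p≡1+2u

  isFixedᵇ : ℕ → Bool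
  isFixedᵇ y = does (Φ (enum y) ≟ enum y)

  count-fixed≤q : count isFixedᵇ (suc N) ≤ q
  count-fixed≤q = ℕ.≤-trans
    (ℕ.+-mono-≤ (count-fixed-by-*1+ (q ∸ 1) (suc q) N≡[q-1]*[q+1] isFixedᵇ fixed) (bool→ℕ≤1 (isFixedᵇ N)))
    (ℕ.≤-reflexive (ℕ.m∸n+n≡m (ℕ.≤-trans (s≤s z≤n) 2≤q)))
    where
    N≡[q-1]*[q+1] : N ≡ (q ∸ 1) * suc q
    N≡[q-1]*[q+1] = square-1 q (ℕ.≤-trans (s≤s z≤n) 2≤q)
      where
      square-1 : ∀ n → 1 ≤ n → n * n ∸ 1 ≡ (n ∸ 1) * suc n
      square-1 (suc a) _ = expand a
        where
        expand : ∀ a → a + a * suc a ≡ a * suc (suc a)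
        expand = solve-∀
    fixed : ∀ y → y < N → T (isFixedᵇ y) → (suc (q ∸ 1) * y) % N ≡ y
    fixed y y<N Φθ^y≈θ^y = ≡.trans (≡.cong (λ n → (n * y) % N) (ℕ.m+[n∸m]≡n (ℕ.≤-trans (s≤s z≤n) 2≤q)))
      (≡.trans (θ^≈θ^⇒%≡% (q * y) y θ^qy≈θ^y) (m<n⇒m%n≡m y<N))
      where
      θ^qy≈θ^y : pow θ (q * y) ≈ pow θ y
      θ^qy≈θ^y = begin
        pow θ (q * y)       ≡⟨ ≡.cong (pow θ) (ℕ.*-comm q y) ⟩
        pow θ (y * q)       ≈⟨ pow-* θ y q ⟩
        Φ (pow θ y)         ≈⟨ Φ-cong (reflexive (enum-< y y<N)) ⟨
        Φ (enum y)          ≈⟨ does-sound (Φ (enum y) ≟ _) Φθ^y≈θ^y ⟩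
        enum y              ≡⟨ enum-< y y<N ⟩
        pow θ y             ∎

  inBᵇ : ℕ → Bool
  inBᵇ b = does ((pow θ b +F pow θ (q * b)) ≟ 1#)

  Tr-θ^ : ∀ b → pow θ b +F pow θ (q * b) ≈ Tr (pow θ b)
  Tr-θ^ b = +-congˡ (trans (reflexive (≡.cong (pow θ) (ℕ.*-comm q b))) (pow-* θ b q))

  inB⇒Tr≈1 : ∀ b → T (inBᵇ b) → Tr (pow θ b) ≈ 1#
  inB⇒Tr≈1 b b∈B = trans (sym (Tr-θ^ b)) (does-sound (_ ≟ 1#) b∈B)

  Tr≈1⇒inB : ∀ b → Tr (pow θ b) ≈ 1# → T (inBᵇ b)
  Tr≈1⇒inB b Tr≈1 = does-complete (_ ≟ 1#) (trans (Tr-θ^ b) Tr≈1)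

  inB-closed : ∀ b → T (inBᵇ b) → T (inBᵇ ((p * b) % N))
  inB-closed b b∈B = Tr≈1⇒inB _ (begin
      Tr (pow θ ((p * b) % N))        ≈⟨ Tr-cong (θ^-mod (p * b)) ⟨
      Tr (pow θ (p * b))              ≈⟨ Tr-cong (trans (reflexive (≡.cong (pow θ) (ℕ.*-comm p b))) (pow-* θ b p)) ⟩
      pow x p +F Φ (pow x p)          ≈⟨ +-congˡ (pow-comm x p q) ⟩
      pow x p +F pow (Φ x) p          ≈⟨ frobenius-+ x (Φ x) ⟨
      pow (Tr x) p                    ≈⟨ pow-cong p (inB⇒Tr≈1 b b∈B) ⟩
      pow 1# p                        ≈⟨ pow-1# p ⟩
      1#                              ∎)
    where
    x = pow θ b

  -- Fibres of Tr have size at most |B|: translating by x₁ - s with Tr x₁ = 1 maps the fibre of s into B.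
  Tr-fibre≤|B| : ∀ s → count (λ i → index (Tr (enum i)) ≡ᵇ index (Tr (enum s))) (suc N) ≤ count inBᵇ N
  Tr-fibre≤|B| s = count-≤-injection _ inBᵇ (λ i → index (translate i)) (suc N) N maps-to injective
    where
    x₁ = proj₁ trace-one

    translate : ℕ → Carrier
    translate i = (enum i +F - enum s) +F x₁

    Tr-translate : ∀ i → T (index (Tr (enum i)) ≡ᵇ index (Tr (enum s))) → Tr (translate i) ≈ 1#
    Tr-translate i same-fibre = begin
      Tr (translate i)                          ≈⟨ Tr-+ _ x₁ ⟩
      Tr (enum i +F - enum s) +F Tr x₁          ≈⟨ +-cong (Tr-+ _ _) (proj₂ trace-one) ⟩
      (Tr (enum i) +F Tr (- enum s)) +F 1#      ≈⟨ +-congʳ (+-cong Tr-i≈Tr-s (Tr-neg (enum s))) ⟩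
      (Tr (enum s) +F - Tr (enum s)) +F 1#      ≈⟨ +-congʳ (-‿inverseʳ _) ⟩
      0# +F 1#                                  ≈⟨ +-identityˡ _ ⟩
      1#                                        ∎
      where
      Tr-i≈Tr-s = index-injective (ℕ.≡ᵇ⇒≡ (index (Tr (enum i))) _ same-fibre)

    maps-to : ∀ i → i < suc N → T (index (Tr (enum i)) ≡ᵇ index (Tr (enum s))) →
              index (translate i) < N Data.Product.× T (inBᵇ (index (translate i)))
    maps-to i _ same-fibre = index<N _ translate≉0 , Tr≈1⇒inB _ (begin
      Tr (pow θ (index (translate i)))  ≡⟨ ≡.cong Tr (enum-< _ (index<N _ translate≉0)) ⟨
      Tr (enum (index (translate i)))   ≈⟨ Tr-cong (enum-index _) ⟩
      Tr (translate i)                  ≈⟨ Tr-translate i same-fibre ⟩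
      1#                                ∎)
      where
      translate≉0 : ¬ (translate i ≈ 0#)
      translate≉0 e = 1≉0 (trans (sym (Tr-translate i same-fibre)) (trans (Tr-cong e) Tr-0))

    injective : ∀ i j → i < suc N → j < suc N → _ → _ → index (translate i) ≡ index (translate j) → i ≡ j
    injective i j i≤N j≤N _ _ e = enum-injective i j (ℕ.≤-pred i≤N) (ℕ.≤-pred j≤N)
      (∙-cancelʳ (- enum s) _ _ (∙-cancelʳ x₁ _ _ (index-injective e)))

  -- q² = |F| is the sum over the ≤ q values of Tr (Tr lands in the fixed field of Φ) of fibre sizes ≤ |B|.
  q≤|B| : q ≤ count inBᵇ N
  q≤|B| = ℕ.*-cancelʳ-≤ q (count inBᵇ N) q (ℕ.≤-trans
    (ℕ.≤-reflexive (≡.trans (≡.sym 1+N≡q*q) (≡.sym (count-true (λ _ → true) (suc N) (λ _ _ → _)))))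
    (ℕ.≤-trans (count-≤-fibres (λ _ → true) isFixedᵇ trF (suc N) (suc N) (count inBᵇ N) maps-to fibre-≤)
               (ℕ.*-monoʳ-≤ (count inBᵇ N) count-fixed≤q)))
    where
    trF : ℕ → ℕ
    trF i = index (Tr (enum i))

    maps-to : ∀ i → i < suc N → T true → trF i < suc N Data.Product.× T (isFixedᵇ (trF i))
    maps-to i _ _ = s≤s (index≤N _) , does-complete (Φ (enum (trF i)) ≟ _) (begin
      Φ (enum (trF i))   ≈⟨ Φ-cong (enum-index _) ⟩
      Φ (Tr (enum i))    ≈⟨ Φ-Tr (enum i) ⟩
      Tr (enum i)        ≈⟨ enum-index _ ⟨
      enum (trF i)       ∎)

    fibre-≤ : ∀ y → y < suc N → T (isFixedᵇ y) → count (λ i → trF i ≡ᵇ y) (suc N) ≤ count inBᵇ N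
    fibre-≤ y _ _ with count (λ i → trF i ≡ᵇ y) (suc N) in eq
    ... | zero  = z≤n
    ... | suc _ with count>0⇒∃ (λ i → trF i ≡ᵇ y) (suc N) (≡.subst (0 <_) (≡.sym eq) (s≤s z≤n))
    ...   | s , _ , trF-s≡y = ≡.subst (_≤ count inBᵇ N) (≡.trans (≡.cong (λ y → count (λ i → trF i ≡ᵇ y) (suc N))
                                 (ℕ.≡ᵇ⇒≡ (trF s) y trF-s≡y)) eq) (Tr-fibre≤|B| s)

module Cycles (N : ℕ) (π : ℕ → ℕ) (P : ℕ) (1≤P : 1 ≤ P) (P≤N : P ≤ N)
  (π-< : ∀ x → x Data.Nat.< N → π x Data.Nat.< N) (period : ∀ x → x Data.Nat.< N → iter π P x ≡ x) where

  open import Data.Nat hiding (_+_; _*_; _∸_; _^_; _≤_)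
  open import Data.Nat.Properties
  open import Data.Nat.DivMod using (m≡m%n+[m/n]*n; m%n<n; _%_; _/_)
  open import Data.Nat.Divisibility using (_∣_; divides; m%n≡0⇒n∣m)
  open import Data.Bool using (Bool; T)
  open import Data.Empty using (⊥-elim)
  open import Relation.Binary.PropositionalEquality
  open import Relation.Binary.Definitions using (tri<; tri≈; tri>)
  open Counting using (T-ext)
  open Search
  open Iteration

  instance
    N≢0 : NonZero N
    N≢0 = >-nonZero (≤-trans 1≤P P≤N)

  iter-< : ∀ s x → x < N → iter π s x < N
  iter-< zero    x x<N = x<N
  iter-< (suc s) x x<N = π-< _ (iter-< s x x<N)

  π-injective : ∀ x y → x < N → y < N → π x ≡ π y → x ≡ y
  π-injective x y x<N y<N e = trans (sym (undo x x<N)) (trans (cong (iter π (P ∸ 1)) e) (undo y y<N))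
    where
    undo : ∀ z → z < N → iter π (P ∸ 1) (π z) ≡ z
    undo z z<N = trans (iter-commute π (P ∸ 1) z) (trans (cong (λ n → iter π n z) (m+[n∸m]≡n 1≤P)) (period z z<N))

  iter-injective : ∀ s x y → x < N → y < N → iter π s x ≡ iter π s y → x ≡ y
  iter-injective zero    x y _   _   e = e
  iter-injective (suc s) x y x<N y<N e =
    iter-injective s x y x<N y<N (π-injective _ _ (iter-< s x x<N) (iter-< s y y<N) e)

  returns : ℕ → ℕ → Bool
  returns b i = iter π (suc i) b ≡ᵇ b

  -- Agrees definitionally with Construction.cycleLen when π is Construction.π.
  cycleLength : ℕ → ℕ
  cycleLength b = suc (search (returns b) N)

  private
    1+[P-1]≡P : suc (P ∸ 1) ≡ P
    1+[P-1]≡P = m+[n∸m]≡n 1≤P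

    search≤P-1 : ∀ b → b < N → search (returns b) N ≤ P ∸ 1
    search≤P-1 b b<N = search≤ (returns b) N (P ∸ 1) (subst (_≤ N) (sym 1+[P-1]≡P) P≤N)
      (≡⇒≡ᵇ _ _ (trans (cong (λ n → iter π n b) 1+[P-1]≡P) (period b b<N)))

  cycleLength≤P : ∀ b → b < N → cycleLength b ≤ P
  cycleLength≤P b b<N = subst (cycleLength b ≤_) 1+[P-1]≡P (s≤s (search≤P-1 b b<N))

  cycleLength<N : ∀ b → b < N → ∀ {s} → s < cycleLength b → s < N
  cycleLength<N b b<N s<m = <-≤-trans s<m (≤-trans (cycleLength≤P b b<N) P≤N)

  iter-cycleLength : ∀ b → b < N → iter π (cycleLength b) b ≡ b
  iter-cycleLength b b<N = ≡ᵇ⇒≡ _ _ (search-found (returns b) N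
    (≤-<-trans (search≤P-1 b b<N) (subst (_≤ N) (sym 1+[P-1]≡P) P≤N)))

  cycleLength-minimal : ∀ b i → 0 < i → i < cycleLength b → iter π i b ≢ b
  cycleLength-minimal b (suc i) _ (s≤s i<m) e = search-least (returns b) N i i<m (≡⇒≡ᵇ _ _ e)

  instance
    cycleLength≢0 : ∀ {b} → NonZero (cycleLength b)
    cycleLength≢0 = _

  iter-*-cycleLength : ∀ b → b < N → ∀ n → iter π (n * cycleLength b) b ≡ b
  iter-*-cycleLength b b<N zero    = refl
  iter-*-cycleLength b b<N (suc n) = trans (iter-+ π (cycleLength b) (n * cycleLength b) b)
    (trans (cong (iter π (cycleLength b)) (iter-*-cycleLength b b<N n)) (iter-cycleLength b b<N))

  iter-∣-cycleLength : ∀ b → b < N → ∀ s → cycleLength b ∣ s → iter π s b ≡ b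
  iter-∣-cycleLength b b<N _ (divides n refl) = iter-*-cycleLength b b<N n

  iter-%-cycleLength : ∀ b → b < N → ∀ s → iter π s b ≡ iter π (s % cycleLength b) b
  iter-%-cycleLength b b<N s = trans (cong (λ n → iter π n b) (m≡m%n+[m/n]*n s (cycleLength b)))
    (trans (iter-+ π (s % cycleLength b) _ b)
           (cong (iter π (s % cycleLength b)) (iter-*-cycleLength b b<N (s / cycleLength b))))

  cycleLength∣P : ∀ b → b < N → cycleLength b ∣ P
  cycleLength∣P b b<N = m%n≡0⇒n∣m P (cycleLength b) P%m≡0
    where
    P%m≡0 : P % cycleLength b ≡ 0
    P%m≡0 with P % cycleLength b in eq
    ... | zero  = refl
    ... | suc r = ⊥-elim (cycleLength-minimal b (suc r) (s≤s z≤n) (subst (_< cycleLength b) eq (m%n<n P _))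
                    (trans (cong (λ n → iter π n b) (sym eq)) (trans (sym (iter-%-cycleLength b b<N P)) (period b b<N))))

  cycleLength-π : ∀ b → b < N → cycleLength (π b) ≡ cycleLength b
  cycleLength-π b b<N = cong suc (search-cong _ _ N λ i → trans (cong (_≡ᵇ π b) (iter-commute π (suc i) b))
    (T-ext (λ t → ≡⇒≡ᵇ _ _ (π-injective _ _ (iter-< (suc i) b b<N) b<N (≡ᵇ⇒≡ _ _ t)))
           (λ t → ≡⇒≡ᵇ _ _ (cong π (≡ᵇ⇒≡ _ _ t)))))

  cycleLength-iter : ∀ s b → b < N → cycleLength (iter π s b) ≡ cycleLength b
  cycleLength-iter zero    b b<N = refl
  cycleLength-iter (suc s) b b<N = trans (cycleLength-π _ (iter-< s b b<N)) (cycleLength-iter s b b<N)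

  iter-distinct : ∀ x s s′ → x < N → s < s′ → s′ < cycleLength x → iter π s x ≢ iter π s′ x
  iter-distinct x s s′ x<N s<s′ s′<m e = cycleLength-minimal x (s′ ∸ s) (m<n⇒0<n∸m s<s′) (≤-<-trans (m∸n≤m s′ s) s′<m)
    (sym (iter-injective s x _ x<N (iter-< (s′ ∸ s) x x<N) (begin
      iter π s x                      ≡⟨ e ⟩
      iter π s′ x                     ≡⟨ cong (λ n → iter π n x) (m∸n+n≡m (<⇒≤ s<s′)) ⟨
      iter π ((s′ ∸ s) + s) x         ≡⟨ cong (λ n → iter π n x) (+-comm (s′ ∸ s) s) ⟩
      iter π (s + (s′ ∸ s)) x         ≡⟨ iter-+ π s (s′ ∸ s) x ⟩
      iter π s (iter π (s′ ∸ s) x)    ∎)))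
    where open ≡-Reasoning

  iter-position-unique : ∀ x s s′ → x < N → s < cycleLength x → s′ < cycleLength x → iter π s x ≡ iter π s′ x → s ≡ s′
  iter-position-unique x s s′ x<N s<m s′<m e with <-cmp s s′
  ... | tri< s<s′ _ _ = ⊥-elim (iter-distinct x s s′ x<N s<s′ s′<m e)
  ... | tri≈ _ s≡s′ _ = s≡s′
  ... | tri> _ _ s′<s = ⊥-elim (iter-distinct x s′ s x<N s′<s s<m (sym e))

  module Representatives {ℓ : Level} (B : ℕ → Set ℓ) (B-closed : ∀ b → b < N → B b → B (π b)) (start : ℕ → ℕ)
    (start-choice : ∀ b → suc b Data.Nat.≤ N → B b →
                      (suc (start b) Data.Nat.≤ N) Data.Product.× B (start b)
                      Data.Product.× (start (π b) ≡ start b) Data.Product.× Σ ℕ (λ s → iter π s (start b) ≡ b)) where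

    open import Data.Product using (_,_; proj₁; proj₂)
    import Relation.Nullary

    -- b = π^(offset b) (start b); Construction.position is offset + 1.
    offset : ℕ → ℕ
    offset b = search (λ s → iter π s (start b) ≡ᵇ b) N

    B-iter : ∀ s x → x < N → B x → B (iter π s x)
    B-iter zero    x _   x∈B = x∈B
    B-iter (suc s) x x<N x∈B = B-closed _ (iter-< s x x<N) (B-iter s x x<N x∈B)

    start-iter : ∀ s x → x < N → B x → start (iter π s x) ≡ start x
    start-iter zero    x _   _   = refl
    start-iter (suc s) x x<N x∈B =
      trans (proj₁ (proj₂ (proj₂ (start-choice _ (iter-< s x x<N) (B-iter s x x<N x∈B))))) (start-iter s x x<N x∈B)

    module _ (b : ℕ) (b<N : b < N) (b∈B : B b) where
      private
        s₀ = start b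
        s₀<N = proj₁ (start-choice b b<N b∈B)
        s₀∈B = proj₁ (proj₂ (start-choice b b<N b∈B))
        w = proj₁ (proj₂ (proj₂ (proj₂ (start-choice b b<N b∈B))))
        π^w[s₀]≡b : iter π w s₀ ≡ b
        π^w[s₀]≡b = proj₂ (proj₂ (proj₂ (proj₂ (start-choice b b<N b∈B))))
        w%m = w % cycleLength s₀
        w%m<m = m%n<n w (cycleLength s₀)
        offset≤w%m : offset b ≤ w%m
        offset≤w%m = search≤ _ N w%m (cycleLength<N s₀ s₀<N w%m<m)
          (≡⇒≡ᵇ _ _ (trans (sym (iter-%-cycleLength s₀ s₀<N w)) π^w[s₀]≡b))

      start-start : start (start b) ≡ start b
      start-start = trans (sym (start-iter w s₀ s₀<N s₀∈B)) (cong start π^w[s₀]≡b)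

      cycleLength-start : cycleLength b ≡ cycleLength (start b)
      cycleLength-start = trans (cong cycleLength (sym π^w[s₀]≡b)) (cycleLength-iter w s₀ s₀<N)

      offset<cycleLength : offset b < cycleLength (start b)
      offset<cycleLength = ≤-<-trans offset≤w%m w%m<m

      iter-offset : iter π (offset b) (start b) ≡ b
      iter-offset = ≡ᵇ⇒≡ _ _ (search-found _ N (≤-<-trans offset≤w%m (cycleLength<N s₀ s₀<N w%m<m)))

    offset-iter : ∀ s₀ e → s₀ < N → B s₀ → start s₀ ≡ s₀ → e < cycleLength s₀ → offset (iter π e s₀) ≡ e
    offset-iter s₀ e s₀<N s₀∈B start≡ e<m = trans
      (search-cong _ (λ s → iter π s s₀ ≡ᵇ iter π e s₀) N
        (λ s → cong (λ x → iter π s x ≡ᵇ iter π e s₀) (trans (start-iter e s₀ s₀<N s₀∈B) start≡)))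
      (search≡ _ N e (cycleLength<N s₀ s₀<N e<m) (≡⇒≡ᵇ (iter π e s₀) _ refl)
        (λ s s<e t → iter-distinct s₀ s e s₀<N s<e e<m (≡ᵇ⇒≡ _ _ t)))

    -- Each element of a cycle of length m ≥ K is taken M₁ times; the m M₁ copies, ranked along the cycle,
    -- fall into blocks of K, and the d-th block is sent to the element at position (d + 1) k, which lies in A.
    module Blocks (B? : ∀ b → Relation.Nullary.Dec (B b)) (k M₁ : ℕ) (1≤k : 1 ≤ k) (1≤M₁ : 1 ≤ M₁) where

      open import Data.Nat.DivMod using (m<n*o⇒m/o<n; m/n*n≤m; [m+kn]%n≡m%n; m<n⇒m%n≡m)
      open import Data.Nat.Divisibility using (_∣?_; divides)
      open import Data.Bool using (_∧_; true)
      open import Relation.Nullary using (does)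
      open import Data.Nat.Tactic.RingSolver using (solve-∀)
      open Counting
      open NumberTheory using (block-end<)

      K : ℕ
      K = k * suc M₁

      instance
        k≢0 : NonZero k
        k≢0 = >-nonZero 1≤k
        M₁≢0 : NonZero M₁
        M₁≢0 = >-nonZero 1≤M₁
        K≢0 : NonZero K
        K≢0 = m*n≢0 k (suc M₁)

      position : ℕ → ℕ
      position b = suc (offset b)

      goodᵇ : ℕ → Bool
      goodᵇ b = does (B? b) ∧ (K ≤ᵇ cycleLength b)

      inAᵇ : ℕ → Bool
      inAᵇ b = does (B? b) ∧ (does (k ≤? cycleLength b) ∧ does (k ∣? position b))

      copyᵇ : ℕ → Bool
      copyᵇ c = goodᵇ (c % N)

      rank : ℕ → ℕ
      rank c = offset (c % N) * M₁ + c / N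

      block : ℕ → ℕ
      block c = rank c / K

      last : ℕ → ℕ
      last c = block c * k + (k ∸ 1)

      target : ℕ → ℕ
      target c = iter π (last c) (start (c % N))

      module Copy (c : ℕ) (c<M₁N : c < M₁ * N) (c-copy : T (copyᵇ c)) where
        b = c % N
        b<N : b < N
        b<N = m%n<n c N
        b∈B : B b
        b∈B = does-sound (B? b) (proj₁ (T-∧⁻ (does (B? b)) _ c-copy))
        s₀ = start b
        s₀<N = proj₁ (start-choice b b<N b∈B)
        s₀∈B = proj₁ (proj₂ (start-choice b b<N b∈B))
        K≤m : K ≤ cycleLength s₀
        K≤m = subst (K ≤_) (cycleLength-start b b<N b∈B) (≤ᵇ⇒≤ K _ (proj₂ (T-∧⁻ (does (B? b)) _ c-copy)))
        c/N<M₁ : c / N < M₁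
        c/N<M₁ = m<n*o⇒m/o<n c<M₁N
        last<m : last c < cycleLength s₀
        last<m = block-end< k M₁ (offset b) (c / N) (cycleLength s₀) (block c) 1≤k
                   (offset<cycleLength b b<N b∈B) c/N<M₁ (m/n*n≤m (rank c) K) K≤m
        target<N : target c < N
        target<N = iter-< (last c) s₀ s₀<N
        start-target : start (target c) ≡ s₀
        start-target = trans (start-iter (last c) s₀ s₀<N s₀∈B) (start-start b b<N b∈B)
        position-target : position (target c) ≡ suc (block c) * k
        position-target = trans (cong suc (offset-iter s₀ (last c) s₀<N s₀∈B (start-start b b<N b∈B) last<m))
          (trans (sym (+-suc (block c * k) (k ∸ 1))) (trans (cong (block c * k +_) (m+[n∸m]≡n 1≤k))
            (+-comm (block c * k) k)))
        target∈A : T (inAᵇ (target c))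
        target∈A = T-∧⁺ _ _ (does-complete (B? _) (B-iter (last c) s₀ s₀<N s₀∈B))
          (T-∧⁺ _ _ (does-complete (k ≤? _) (≤-trans (m≤m*n k (suc M₁))
                       (subst (K ≤_) (sym (cycleLength-iter (last c) s₀ s₀<N)) K≤m)))
                    (does-complete (k ∣? _) (divides (suc (block c)) position-target)))

      rank%M₁ : ∀ j u → u < M₁ → (j * M₁ + u) % M₁ ≡ u
      rank%M₁ j u u<M₁ = trans (cong (_% M₁) (+-comm (j * M₁) u)) (trans ([m+kn]%n≡m%n u j M₁) (m<n⇒m%n≡m u<M₁))

      -- Within a fibre of target the start and the block are fixed, so rank c % K recovers c.
      fibre-injective : ∀ a c c′ → c < M₁ * N → c′ < M₁ * N →
        T (copyᵇ c ∧ (target c ≡ᵇ a)) → T (copyᵇ c′ ∧ (target c′ ≡ᵇ a)) → rank c % K ≡ rank c′ % K → c ≡ c′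
      fibre-injective a c c′ c<M₁N c′<M₁N fc fc′ e = begin
          c                      ≡⟨ m≡m%n+[m/n]*n c N ⟩
          c % N + (c / N) * N    ≡⟨ cong₂ (λ x y → x + y * N) b≡b′ u≡u′ ⟩
          c′ % N + (c′ / N) * N  ≡⟨ m≡m%n+[m/n]*n c′ N ⟨
          c′                     ∎
        where
        open ≡-Reasoning
        module X = Copy c c<M₁N (proj₁ (T-∧⁻ (copyᵇ c) _ fc))
        module Y = Copy c′ c′<M₁N (proj₁ (T-∧⁻ (copyᵇ c′) _ fc′))
        same-target : target c ≡ target c′
        same-target = trans (≡ᵇ⇒≡ _ _ (proj₂ (T-∧⁻ (copyᵇ c) _ fc))) (sym (≡ᵇ⇒≡ _ _ (proj₂ (T-∧⁻ (copyᵇ c′) _ fc′))))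
        same-start : X.s₀ ≡ Y.s₀
        same-start = trans (sym X.start-target) (trans (cong start same-target) Y.start-target)
        same-last : last c ≡ last c′
        same-last = iter-position-unique X.s₀ (last c) (last c′) X.s₀<N X.last<m
          (subst (λ s → last c′ < cycleLength s) (sym same-start) Y.last<m)
          (trans same-target (cong (iter π (last c′)) (sym same-start)))
        same-block : block c ≡ block c′
        same-block = *-cancelʳ-≡ (block c) (block c′) k (+-cancelʳ-≡ (k ∸ 1) _ _ same-last)
        same-rank : rank c ≡ rank c′
        same-rank = trans (m≡m%n+[m/n]*n (rank c) K)
          (trans (cong₂ (λ x y → x + y * K) e same-block) (sym (m≡m%n+[m/n]*n (rank c′) K)))
        u≡u′ : c / N ≡ c′ / N
        u≡u′ = trans (sym (rank%M₁ (offset X.b) (c / N) X.c/N<M₁))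
                 (trans (cong (_% M₁) same-rank) (rank%M₁ (offset Y.b) (c′ / N) Y.c/N<M₁))
        b≡b′ : c % N ≡ c′ % N
        b≡b′ = trans (sym (iter-offset X.b X.b<N X.b∈B))
          (trans (cong₂ (iter π) (*-cancelʳ-≡ (offset X.b) (offset Y.b) M₁ (+-cancelʳ-≡ (c / N) _ _
                   (trans same-rank (cong (offset Y.b * M₁ +_) (sym u≡u′))))) same-start)
                 (iter-offset Y.b Y.b<N Y.b∈B))

      M₁*good≤K*A : M₁ * count goodᵇ N ≤ K * count inAᵇ N
      M₁*good≤K*A = subst (_≤ K * count inAᵇ N) (count-% goodᵇ N M₁)
        (count-≤-fibres copyᵇ inAᵇ target (M₁ * N) N K
          (λ c c<M₁N c-copy → Copy.target<N c c<M₁N c-copy , Copy.target∈A c c<M₁N c-copy)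
          (λ a _ _ → ≤-trans (count-≤-injection _ (λ _ → true) (λ c → rank c % K) (M₁ * N) K
                                (λ c _ _ → m%n<n (rank c) K , _) (fibre-injective a))
                              (≤-reflexive (count-true _ K (λ _ _ → _)))))

module MultiplicationModulo (N p : ℕ) .{{_ : Data.Nat.NonZero N}} where

  open import Data.Nat using (zero; suc; _<_; NonZero)
  open import Data.Nat.Properties using (+-identityʳ; *-assoc)
  open import Data.Nat.DivMod using (_%_; m%n<n; m<n⇒m%n≡m; %-distribˡ-*; m%n%n≡m%n)
  open import Relation.Binary.PropositionalEquality

  modN≡% : ∀ n x .{{_ : NonZero n}} → modN n x ≡ x % n
  modN≡% (suc n) x = refl

  μ : ℕ → ℕ
  μ x = modN N (p * x)

  μ-< : ∀ x → μ x < N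
  μ-< x = subst (_< N) (sym (modN≡% N (p * x))) (m%n<n (p * x) N)

  iter-μ : ∀ s x → x < N → iter μ s x ≡ (p ^ s * x) % N
  iter-μ zero    x x<N = sym (trans (cong (_% N) (+-identityʳ x)) (m<n⇒m%n≡m x<N))
  iter-μ (suc s) x x<N = begin
      modN N (p * iter μ s x)          ≡⟨ modN≡% N _ ⟩
      (p * iter μ s x) % N             ≡⟨ cong (λ y → (p * y) % N) (iter-μ s x x<N) ⟩
      (p * ((p ^ s * x) % N)) % N      ≡⟨ %-distribˡ-* p _ N ⟩
      ((p % N) * ((p ^ s * x) % N % N)) % N ≡⟨ cong (λ y → ((p % N) * y) % N) (m%n%n≡m%n (p ^ s * x) N) ⟩
      ((p % N) * ((p ^ s * x) % N)) % N ≡⟨ %-distribˡ-* p (p ^ s * x) N ⟨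
      (p * (p ^ s * x)) % N            ≡⟨ cong (_% N) (*-assoc p (p ^ s) x) ⟨
      (p ^ suc s * x) % N              ∎
    where open ≡-Reasoning

  iter-μ-period : ∀ P → p ^ P ≡ suc N → ∀ x → x < N → iter μ P x ≡ x
  iter-μ-period P p^P≡1+N x x<N = begin
      iter μ P x         ≡⟨ iter-μ P x x<N ⟩
      (p ^ P * x) % N    ≡⟨ cong (λ n → (n * x) % N) p^P≡1+N ⟩
      (x + N * x) % N    ≡⟨ %-remove-+ʳ x (m∣m*n x) ⟩
      x % N              ≡⟨ m<n⇒m%n≡m x<N ⟩
      x                  ∎
    where
    open ≡-Reasoning
    open import Data.Nat.DivMod using (%-remove-+ʳ)
    open import Data.Nat.Divisibility using (m∣m*n)

module CardinalityOfA {c ℓ : Level} (k p M₁ r i : ℕ) (2≤k : 2 ≤ k) (p-prime : Prime p) (1≤M₁ : 1 ≤ M₁) (r-prime : Prime r)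
  (Mk<r : Data.Nat.suc M₁ * k + 1 ≤ r)
  (F : CommutativeRing c ℓ) (isField : FieldDefs.IsField F) (_≟_ : Decidable (CommutativeRing._≈_ F))
  (θ : CommutativeRing.Carrier F) (gen : FieldDefs.IsGenerator F θ (p ^ (r ^ i) * p ^ (r ^ i) ∸ 1))
  (start : ℕ → ℕ) (start-choice : FieldDefs.Construction.StartChoice F _≟_ θ p (p ^ (r ^ i)) k start) where

  open import Data.Nat using (suc; _<_; z≤n; s≤s; _≤ᵇ_)
  open import Data.Nat.Properties hiding (_≟_)
  open import Data.Nat.Divisibility using (_∣_; divides; ∣-refl)
  open import Data.Nat.DivMod using (_%_)
  open import Data.Bool using (Bool; T; _∧_; not; true; false)
  open import Data.Product using (Σ; _,_; proj₁; proj₂)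
  open import Relation.Binary.PropositionalEquality
  open Counting
  open NumberTheory using (odd-prime; odd-^; n<2^n; ^≡1+multiple; ∣rⁱ*2⇒r≤; count-fixed-by-*1+)

  t : ℕ
  t = r ^ i

  K : ℕ
  K = k * suc M₁

  K<r : K < r
  K<r = ≤-trans (≤-reflexive (trans (+-comm 1 K) (cong (_+ 1) (*-comm k (suc M₁))))) Mk<r

  3≤r : 3 ≤ r
  3≤r = ≤-trans (s≤s (≤-trans 2≤k (m≤m*n k (suc M₁)))) K<r

  t-odd : Σ ℕ λ s → t ≡ suc (2 * s)
  t-odd with odd-prime r-prime 3≤r
  ... | a , r≡1+2a = proj₁ (odd-^ a i) , trans (cong (_^ i) r≡1+2a) (proj₂ (odd-^ a i))

  open Trace F isField _≟_ θ p t p-prime t-odd gen using (q; N; inBᵇ; inB-closed; q≤|B|; 1+N≡q*q; 2≤p; p≢0)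
  open FieldTheory.Cyclic F isField _≟_ θ N gen using (N≢0)
  module C = FieldDefs.Construction F _≟_ θ p q k
  open MultiplicationModulo N p using (modN≡%; μ-<; iter-μ; iter-μ-period)

  P : ℕ
  P = t + t

  p^P≡1+N : p ^ P ≡ suc N
  p^P≡1+N = trans (^-distribˡ-+-* p t t) (sym 1+N≡q*q)

  1≤P : 1 ≤ P
  1≤P = ≤-trans (subst (1 ≤_) (sym (proj₂ t-odd)) (s≤s z≤n)) (m≤m+n t t)

  P≤N : P ≤ N
  P≤N = ≤-pred (≤-trans (n<2^n P) (≤-trans (^-monoˡ-≤ P 2≤p) (≤-reflexive p^P≡1+N)))

  open Cycles N C.π P 1≤P P≤N (λ x _ → μ-< x) (iter-μ-period P p^P≡1+N)

  B-closed : ∀ b → b < N → C.InB b → C.InB (C.π b)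
  B-closed b _ b∈B = subst C.InB (sym (modN≡% N (p * b)))
    (does-sound (C.inB? _) (inB-closed b (does-complete (C.inB? b) b∈B)))

  open Representatives C.InB B-closed start start-choice
  open Blocks C.inB? k M₁ (≤-trans (s≤s z≤n) 2≤k) 1≤M₁ hiding (K)

  cardA≡count-A : C.cardA start ≡ count inAᵇ N
  cardA≡count-A = length-filter≡count (C.inA? start) (λ b → b) N

  long : ℕ → Bool
  long b = inBᵇ b ∧ (3 ≤ᵇ cycleLength b)

  short : ℕ → Bool
  short b = inBᵇ b ∧ not (3 ≤ᵇ cycleLength b)

  -- Cycle lengths divide 2 rⁱ, so a cycle longer than 2 has length at least r > K.
  count-long≤count-good : count long N ≤ count goodᵇ N
  count-long≤count-good = count-mono long goodᵇ N λ b b<N b-long →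
    let b∈B , 3≤m = T-∧⁻ (inBᵇ b) _ b-long
    in T-∧⁺ (inBᵇ b) _ b∈B (≤⇒≤ᵇ (≤-trans (<⇒≤ K<r)
         (∣rⁱ*2⇒r≤ i r-prime (subst (cycleLength b ∣_) P≡rⁱ*2 (cycleLength∣P b b<N)) (≤ᵇ⇒≤ 3 _ 3≤m))))
    where
    P≡rⁱ*2 : P ≡ r ^ i * 2
    P≡rⁱ*2 = trans (cong (t +_) (sym (+-identityʳ t))) (*-comm 2 t)

  -- Elements on cycles of length 1 or 2 are fixed by multiplication with p², hence multiples of N / (p² - 1).
  count-short≤p⁴-1 : count short N ≤ p ^ 4 ∸ 1
  count-short≤p⁴-1 = ≤-trans (count-fixed-by-*1+ (p ^ 2 ∸ 1) g N≡[p²-1]*g short fixed)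
                             (∸-monoˡ-≤ 1 (^-monoʳ-≤ p {2} {4} (s≤s (s≤s z≤n))))
    where
    1+[p²-1]≡p² : suc (p ^ 2 ∸ 1) ≡ p ^ 2
    1+[p²-1]≡p² = m+[n∸m]≡n (m^n>0 p 2)
    g = proj₁ (^≡1+multiple (p ^ 2 ∸ 1) t)
    N≡[p²-1]*g : N ≡ (p ^ 2 ∸ 1) * g
    N≡[p²-1]*g = begin
      q * q ∸ 1                 ≡⟨ cong (_∸ 1) (^-distribˡ-+-* p t t) ⟨
      p ^ (t + t) ∸ 1           ≡⟨ cong (λ n → p ^ n ∸ 1) (cong (t +_) (sym (+-identityʳ t))) ⟩
      p ^ (2 * t) ∸ 1           ≡⟨ cong (_∸ 1) (^-*-assoc p 2 t) ⟨
      (p ^ 2) ^ t ∸ 1           ≡⟨ cong (λ n → n ^ t ∸ 1) 1+[p²-1]≡p² ⟨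
      suc (p ^ 2 ∸ 1) ^ t ∸ 1   ≡⟨ cong (_∸ 1) (proj₂ (^≡1+multiple (p ^ 2 ∸ 1) t)) ⟩
      (p ^ 2 ∸ 1) * g           ∎
      where open ≡-Reasoning
    fixed : ∀ y → y < N → T (short y) → (suc (p ^ 2 ∸ 1) * y) % N ≡ y
    fixed y y<N y-short = begin
      (suc (p ^ 2 ∸ 1) * y) % N  ≡⟨ cong (λ n → (n * y) % N) 1+[p²-1]≡p² ⟩
      (p ^ 2 * y) % N            ≡⟨ iter-μ 2 y y<N ⟨
      iter C.π 2 y               ≡⟨ iter-∣-cycleLength y y<N 2 (≤2⇒∣2 (cycleLength y) (s≤s z≤n) m≤2) ⟩
      y                          ∎
      where
      open ≡-Reasoning
      m≤2 : cycleLength y ≤ 2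
      m≤2 = ≤-pred (≰⇒> (λ 3≤m → subst T (not-T (≤⇒≤ᵇ 3≤m)) (proj₂ (T-∧⁻ (inBᵇ y) _ y-short))))
        where
        not-T : ∀ {b} → T b → not b ≡ false
        not-T {true} _ = refl
      ≤2⇒∣2 : ∀ m → 1 ≤ m → m ≤ 2 → m ∣ 2
      ≤2⇒∣2 1 _ _ = divides 2 refl
      ≤2⇒∣2 2 _ _ = ∣-refl
      ≤2⇒∣2 (suc (suc (suc _))) _ (s≤s (s≤s ()))

  lower-bound : q * M₁ ≤ K * C.cardA start + K * ((p ^ 4 ∸ 1) * M₁)
  lower-bound = begin
    q * M₁                                    ≤⟨ *-monoˡ-≤ M₁ q≤|B| ⟩
    count inBᵇ N * M₁                         ≡⟨ cong (_* M₁) (count-split inBᵇ (λ b → 3 ≤ᵇ cycleLength b) N) ⟩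
    (count long N + count short N) * M₁       ≡⟨ *-distribʳ-+ M₁ (count long N) (count short N) ⟩
    count long N * M₁ + count short N * M₁    ≤⟨ +-mono-≤ long-bound short-bound ⟩
    K * C.cardA start + K * ((p ^ 4 ∸ 1) * M₁) ∎
    where
    open ≤-Reasoning hiding (start)
    long-bound : count long N * M₁ ≤ K * C.cardA start
    long-bound = begin
      count long N * M₁     ≡⟨ *-comm (count long N) M₁ ⟩
      M₁ * count long N     ≤⟨ *-monoʳ-≤ M₁ count-long≤count-good ⟩
      M₁ * count goodᵇ N    ≤⟨ M₁*good≤K*A ⟩
      K * count inAᵇ N      ≡⟨ cong (K *_) cardA≡count-A ⟨
      K * C.cardA start     ∎
    short-bound : count short N * M₁ ≤ K * ((p ^ 4 ∸ 1) * M₁)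
    short-bound = ≤-trans (*-monoˡ-≤ M₁ count-short≤p⁴-1) (m≤n*m _ K)

open import Data.Nat using (suc; z≤n; s≤s)
open import Data.Nat.Properties using (≤-trans; ≤-reflexive; *-zeroʳ)

lemma3p3 : {c ℓ : Level} (k p M r i : ℕ) → 2 ≤ k → Prime p → 1 ≤ M → Prime r → M * k + 1 ≤ r → 1 ≤ i →
    (F : CommutativeRing c ℓ) → FieldDefs.IsField F → (_≟_ : Decidable (CommutativeRing._≈_ F)) →
    (θ : CommutativeRing.Carrier F) → FieldDefs.IsGenerator F θ (p ^ (r ^ i) * p ^ (r ^ i) ∸ 1) →
    (start : ℕ → ℕ) → FieldDefs.Construction.StartChoice F _≟_ θ p (p ^ (r ^ i)) k start →
    p ^ (r ^ i) * (M ∸ 1)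
      ≤ k * M * FieldDefs.Construction.cardA F _≟_ θ p (p ^ (r ^ i)) k start
        + k * M * ((p ^ 4 ∸ 1) * (M ∸ 1))
lemma3p3 k p 0 r i _ _ () _ _ _ F _ _ θ _ start _
lemma3p3 k p 1 r i _ _ _ _ _ _ F _ _ θ _ start _ = ≤-trans (≤-reflexive (*-zeroʳ (p ^ (r ^ i)))) z≤n
lemma3p3 k p (suc (suc M₂)) r i 2≤k p-prime _ r-prime Mk<r _ F isField _≟_ θ gen start start-choice =
  CardinalityOfA.lower-bound k p (suc M₂) r i 2≤k p-prime (s≤s z≤n) r-prime Mk<r F isField _≟_ θ gen start start-choice
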